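{- Let $a\ge 1$. If $a\equiv 0$ or $2\pmod 3$, rowmotion on the lower order ideals of the circular fence $\overline{F}(a,1,1,1)$ has a unique orbit, of size $3a+4$, and $\overline{\chi}$ is homomesic. If $a\equiv 1\pmod 3$, rowmotion has exactly $3$ orbits, of sizes $a+2$, $a+1$ and $a+1$, with $\overline{\chi}$ values $(a+2)(a+3)/2$, $(a+2)(a+3)/2$ and $a(a+3)/2$ respectively.
   Context: For a composition $\alpha=(\alpha_1,\ldots,\alpha_{2s})$ of $n$ (positive integers summing to $n$), the circular fence $\overline{F}(\alpha)$ is the poset on $x_1,\ldots,x_n$ (indices mod $n$) generated by $x_1\preceq\cdots\preceq x_{\alpha_1+1}\succeq\cdots\succeq x_{\alpha_1+\alpha_2+1}\preceq\cdots\succeq x_{n+1}=x_1$ (first $\alpha_1$ steps up, next $\alpha_2$ down, alternately). Rowmotion sends a lower order ideal $I$ to the lower ideal generated by the minimal elements of the complement of $I$. For an orbit $\mathcal{O}$, $\overline{\chi}(\mathcal{O})=\sum_{I\in\mathcal{O}}|I|$; $\overline{\chi}$ is homomesic if $\overline{\chi}(\mathcal{O})/|\mathcal{O}|$ is the same for all orbits. -}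

module Defs where

open import Data.Bool using (Bool; true; false; not; _∧_; _∨_; if_then_else_)
open import Data.Nat using (ℕ; zero; suc; _+_; _*_; _∸_; _<ᵇ_; _≡ᵇ_; _<_)
open import Data.List using (List; []; _∷_; allFin)
open import Data.Nat.ListAction using (sum)
open import Data.Bool.ListAction using (any; all)
open import Data.Fin using (Fin; toℕ; _≟_)
open import Data.Fin.Subset using (Subset; ⁅_⁆; ∣_∣)
open import Data.Vec using (tabulate; lookup)
open import Relation.Nullary.Decidable using (⌊_⌋)
open import Relation.Binary.PropositionalEquality using (_≡_; _≢_)
open import Data.Product using (Σ; _×_; ∃)

iter : {A : Set} → (A → A) → ℕ → A → A
iter f zero    x = x
iter f (suc k) x = f (iter f k x)

-- Direction of the k-th step (0-indexed; step k joins x_{k+1} and x_{k+2},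
-- indices mod n) of the circular fence of composition α: the first α₁ steps
-- go up, the next α₂ go down, alternately.  true = up.
stepDir : Bool → List ℕ → ℕ → Bool
stepDir d []      k = d
stepDir d (a ∷ r) k = if k <ᵇ a then d else stepDir (not d) r (k ∸ a)

up : List ℕ → ℕ → Bool
up α k = stepDir true α k

module CircularFence (α : List ℕ) where

  -- number of elements; element i : Fin n stands for x_{i+1}
  n : ℕ
  n = sum α

  isNext : ℕ → ℕ → Bool
  isNext i j = (suc i ≡ᵇ j) ∨ ((suc i ≡ᵇ n) ∧ (j ≡ᵇ 0))

  cov : Fin n → Fin n → Bool
  cov x y = (up α (toℕ x) ∧ isNext (toℕ x) (toℕ y))
          ∨ (not (up α (toℕ y)) ∧ isNext (toℕ y) (toℕ x))

  anyFin : (Fin n → Bool) → Bool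
  anyFin p = any p (allFin n)

  allFin? : (Fin n → Bool) → Bool
  allFin? p = all p (allFin n)

  stepDown : Subset n → Subset n
  stepDown S = tabulate λ x → lookup S x ∨ anyFin (λ z → lookup S z ∧ cov x z)

  -- principal down-set of y: reflexive–transitive closure of the generating
  -- relations (n closure steps suffice, paths have length < n)
  downset : Fin n → Subset n
  downset y = iter stepDown n ⁅ y ⁆

  leq : Fin n → Fin n → Bool
  leq x y = lookup (downset y) x

  IsIdeal : Subset n → Set
  IsIdeal I = ∀ x y → leq x y ≡ true → lookup I y ≡ true → lookup I x ≡ true

  minCompl : Subset n → Fin n → Bool
  minCompl I m = not (lookup I m)
               ∧ allFin? (λ x → not (leq x m) ∨ ⌊ x ≟ m ⌋ ∨ lookup I x)

  row : Subset n → Subset n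
  row I = tabulate λ x → anyFin (λ m → minCompl I m ∧ leq x m)

  IsPeriod : Subset n → ℕ → Set
  IsPeriod I p = (0 < p) × (iter row p I ≡ I)
               × (∀ k → 0 < k → k < p → iter row k I ≢ I)

  InOrbit : Subset n → Subset n → Set
  InOrbit I J = ∃ λ k → iter row k I ≡ J

  -- χ̄ of the orbit of I, given its size p: Σ_{j<p} |row^j I|
  chi : Subset n → ℕ → ℕ
  chi I zero    = 0
  chi I (suc p) = ∣ I ∣ + chi (row I) p

  -- χ̄ is homomesic: average χ̄(O)/|O| is the same for all orbits
  Homomesic : Set
  Homomesic = ∀ I J p q → IsIdeal I → IsIdeal J → IsPeriod I p → IsPeriod J q
            → chi I p * q ≡ chi J q * p

fenceA111 : ℕ → List ℕ
fenceA111 a = a ∷ 1 ∷ 1 ∷ 1 ∷ []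

-- An ideal of F̄(a,1,1,1) is a down-closed prefix x_1 … x_K of the chain x_1 ≺ ⋯ ≺ x_{a+1} together
-- with a choice of the two remaining elements, so it is described by K and a phase recording which of
-- x_{a+2}, x_{a+3} it contains.  Away from the top of the chain rowmotion increments K and advances the
-- phase cyclically with period 3; at K = a and K = a + 1 it jumps back to K ∈ {0, 1, a + 1}.  The
-- orbits are therefore concatenations of runs along the chain, joined according to the phase reached
-- after a steps, i.e. according to a mod 3.  For a ≢ 1 the runs close up into a single cycle through
-- all 3a + 4 ideals, so homomesy is automatic; for a ≡ 1 they form three cycles, and their sums of
-- ideal sizes follow from Gauss's formula for the chain part plus the phase contributions.

module Submission where

open import Defs
open import Data.Bool using (Bool; true; false; not; _∧_; _∨_; if_then_else_; T)
open import Data.Bool.Properties using (T-≡; ∨-zeroʳ)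
open import Data.Empty using (⊥-elim)
open import Data.Fin using (Fin; toℕ; fromℕ<) renaming (_≟_ to _≟ᶠ_)
open import Data.Fin.Properties using (toℕ-injective; toℕ<n; toℕ-fromℕ<; fromℕ<-toℕ)
open import Data.Fin.Subset using (Subset; ⁅_⁆; ∣_∣)
open import Data.Fin.Subset.Properties using (x∈⁅x⁆; x∈⁅y⁆⇒x≡y)
open import Data.List using (List; []; _∷_; [_]; _++_; map; allFin)
open import Data.List.Membership.Propositional using (_∈_; _∉_; lose)
open import Data.List.Membership.Propositional.Properties using (∈-allFin; ∈-++⁺ˡ; ∈-++⁺ʳ; ∈-++⁻)
open import Data.List.Properties using (map-++; map-∘; ∷-injectiveʳ)
open import Data.List.Relation.Unary.All as All using ()
open import Data.List.Relation.Unary.All.Properties using (all⁺; all⁻)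
open import Data.List.Relation.Unary.Any using (here; there; satisfied)
open import Data.List.Relation.Unary.Any.Properties using (any⁺; any⁻)
open import Data.Nat using (ℕ; zero; suc; _+_; _*_; _∸_; _%_; _/_; _≤_; _<_; _<ᵇ_; _≡ᵇ_; z≤n; s≤s; s≤s⁻¹; z<s; s<s)
open import Data.Nat.DivMod using (m≡m%n+[m/n]*n; m%n<n)
open import Data.Nat.ListAction using (sum)
open import Data.Nat.ListAction.Properties using (sum-++)
open import Data.Nat.Properties
open import Data.Nat.Tactic.RingSolver using (solve-∀)
open import Data.Product using (Σ; _×_; ∃-syntax; _,_; proj₁; proj₂)
open import Data.Sum using (_⊎_; inj₁; inj₂; [_,_]′)
open import Data.Unit using (⊤; tt)
open import Data.Vec using (tabulate; lookup)
open import Data.Vec.Properties using (lookup∘tabulate; tabulate-cong; tabulate∘lookup; []=⇒lookup; lookup⇒[]=)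
open import Function using (_∘_; Equivalence)
open import Relation.Binary.Definitions using (tri<; tri≈; tri>)
open import Relation.Binary.PropositionalEquality
  using (_≡_; _≢_; refl; sym; trans; cong; cong₂; subst; subst₂; module ≡-Reasoning)
open import Relation.Nullary using (¬_; yes; no)
open import Relation.Nullary.Decidable using (⌊_⌋)

open ≡-Reasoning

T⇒≡ : ∀ {b} → T b → b ≡ true
T⇒≡ = Equivalence.to T-≡

≡⇒T : ∀ {b} → b ≡ true → T b
≡⇒T = Equivalence.from T-≡

∨-true⁻ : ∀ {b c} → b ∨ c ≡ true → b ≡ true ⊎ c ≡ true
∨-true⁻ {true}  _ = inj₁ refl
∨-true⁻ {false} e = inj₂ e

∧-true⁻ : ∀ {b c} → b ∧ c ≡ true → b ≡ true × c ≡ true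
∧-true⁻ {true} {true} _ = refl , refl

true⇒≢false : ∀ {b} → b ≡ true → b ≢ false
true⇒≢false refl ()

not-true⁻ : ∀ {b} → not b ≡ true → b ≡ false
not-true⁻ {false} _ = refl

≡true-ext : ∀ {b c} → (b ≡ true → c ≡ true) → (c ≡ true → b ≡ true) → b ≡ c
≡true-ext {true}  b⇒c _ = sym (b⇒c refl)
≡true-ext {false} {true}  _ c⇒b = c⇒b refl
≡true-ext {false} {false} _ _   = refl

≡ᵇ-refl : ∀ i → (i ≡ᵇ i) ≡ true
≡ᵇ-refl i = T⇒≡ (≡⇒≡ᵇ i i refl)

<ᵇ-true : ∀ {m n} → m < n → (m <ᵇ n) ≡ true
<ᵇ-true m<n = T⇒≡ (<⇒<ᵇ m<n)

<ᵇ-true⁻ : ∀ {m n} → (m <ᵇ n) ≡ true → m < n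
<ᵇ-true⁻ {m} {n} e = <ᵇ⇒< m n (≡⇒T e)

<ᵇ-false : ∀ {m n} → n ≤ m → (m <ᵇ n) ≡ false
<ᵇ-false {m} {n} n≤m with m <ᵇ n in e
... | true  = ⊥-elim (<⇒≱ (<ᵇ-true⁻ e) n≤m)
... | false = refl

downClosed-initial : ∀ (P : ℕ → Bool) m → (∀ {i j} → i ≤ j → j < m → P j ≡ true → P i ≡ true) →
                     ∃[ K ] K ≤ m × (∀ i → i < m → P i ≡ (i <ᵇ K))
downClosed-initial P zero    down = 0 , z≤n , λ _ ()
downClosed-initial P (suc m) down with P m in Pm
... | true = suc m , ≤-refl , λ i i<1+m → trans (down (s≤s⁻¹ i<1+m) (n<1+n m) Pm) (sym (<ᵇ-true i<1+m))
... | false with downClosed-initial P m (λ i≤j j<m → down i≤j (m<n⇒m<1+n j<m))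
...   | K , K≤m , initial = K , m≤n⇒m≤1+n K≤m , extend
  where
  extend : ∀ i → i < suc m → P i ≡ (i <ᵇ K)
  extend i i<1+m with i ≟ m
  ... | yes refl = trans Pm (sym (<ᵇ-false K≤m))
  ... | no  i≢m  = initial i (≤∧≢⇒< (s≤s⁻¹ i<1+m) i≢m)

-- 2 (S + k) = Q, obtained from 2 S + c = P and P + 2 k = Q + c without subtracting c
double-sum : ∀ S {P Q} c k → 2 * S + c ≡ P → P + 2 * k ≡ Q + c → 2 * (S + k) ≡ Q
double-sum S {P} {Q} c k 2S+c≡P P+2k≡Q+c = +-cancelʳ-≡ c _ _ (begin
  2 * (S + k) + c     ≡⟨ regroup S k c ⟩
  (2 * S + c) + 2 * k ≡⟨ cong (_+ 2 * k) 2S+c≡P ⟩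
  P + 2 * k           ≡⟨ P+2k≡Q+c ⟩
  Q + c               ∎)
  where
  regroup : ∀ S k c → 2 * (S + k) + c ≡ (2 * S + c) + 2 * k
  regroup = solve-∀

bit : Bool → ℕ
bit b = if b then 1 else 0

count : (ℕ → Bool) → ℕ → ℕ
count g zero    = 0
count g (suc k) = bit (g 0) + count (g ∘ suc) k

∣tabulate∣ : ∀ k (g : ℕ → Bool) → ∣ tabulate {n = k} (g ∘ toℕ) ∣ ≡ count g k
∣tabulate∣ zero    g = refl
∣tabulate∣ (suc k) g with g 0
... | true  = cong suc (∣tabulate∣ k (g ∘ suc))
... | false = ∣tabulate∣ k (g ∘ suc)

count-+ : ∀ g j k → count g (j + k) ≡ count g j + count (λ i → g (j + i)) k
count-+ g zero    k = refl
count-+ g (suc j) k = trans (cong (bit (g 0) +_) (count-+ (g ∘ suc) j k)) (sym (+-assoc (bit (g 0)) _ _))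

count-cong : ∀ {g h} k → (∀ i → i < k → g i ≡ h i) → count g k ≡ count h k
count-cong zero    _     = refl
count-cong (suc k) g≡h = cong₂ _+_ (cong bit (g≡h 0 z<s)) (count-cong k (λ i i<k → g≡h (suc i) (s<s i<k)))

count-<ᵇ : ∀ {K} k → K ≤ k → count (_<ᵇ K) k ≡ K
count-<ᵇ {zero}  zero    _ = refl
count-<ᵇ {zero}  (suc k) _ = count-<ᵇ k z≤n
count-<ᵇ {suc K} (suc k) K<k = cong suc (count-<ᵇ k (s≤s⁻¹ K<k))

∉-++ : ∀ {A : Set} {x : A} xs {ys} → x ∉ xs → x ∉ ys → x ∉ xs ++ ys
∉-++ xs x∉xs x∉ys x∈ with ∈-++⁻ xs x∈
... | inj₁ x∈xs = x∉xs x∈xs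
... | inj₂ x∈ys = x∉ys x∈ys

-- Iteration, trajectories and minimal periods of an endofunction

module Iteration {X : Set} (f : X → X) where

  iter-+ : ∀ m k x → iter f (m + k) x ≡ iter f m (iter f k x)
  iter-+ zero    k x = refl
  iter-+ (suc m) k x = cong f (iter-+ m k x)

  iter-comm : ∀ k x → iter f k (f x) ≡ f (iter f k x)
  iter-comm zero    x = refl
  iter-comm (suc k) x = cong f (iter-comm k x)

  iter-swap : ∀ m k x → iter f m (iter f k x) ≡ iter f k (iter f m x)
  iter-swap m k x = begin
    iter f m (iter f k x)  ≡⟨ iter-+ m k x ⟨
    iter f (m + k) x       ≡⟨ cong (λ j → iter f j x) (+-comm m k) ⟩
    iter f (k + m) x       ≡⟨ iter-+ k m x ⟩
    iter f k (iter f m x)  ∎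

  iter-periodic : ∀ {p x} → iter f p x ≡ x → ∀ q → iter f (q * p) x ≡ x
  iter-periodic e zero = refl
  iter-periodic {p} {x} e (suc q) =
    trans (iter-+ p (q * p) x) (trans (cong (iter f p) (iter-periodic e q)) e)

  iter-mod : ∀ {p x} → iter f (suc p) x ≡ x → ∀ k → iter f k x ≡ iter f (k % suc p) x
  iter-mod {p} {x} e k = begin
    iter f k x                                       ≡⟨ cong (λ j → iter f j x) (m≡m%n+[m/n]*n k (suc p)) ⟩
    iter f (k % suc p + k / suc p * suc p) x         ≡⟨ iter-+ (k % suc p) _ x ⟩
    iter f (k % suc p) (iter f (k / suc p * suc p) x) ≡⟨ cong (iter f (k % suc p)) (iter-periodic e (k / suc p)) ⟩
    iter f (k % suc p) x                             ∎

  iter-return : ∀ {p x} → iter f (suc p) x ≡ x → ∀ k → iter f (k * p) (iter f k x) ≡ x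
  iter-return {p} {x} e k = begin
    iter f (k * p) (iter f k x)  ≡⟨ iter-+ (k * p) k x ⟨
    iter f (k * p + k) x         ≡⟨ cong (λ j → iter f j x) (trans (+-comm (k * p) k) (sym (*-suc k p))) ⟩
    iter f (k * suc p) x         ≡⟨ iter-periodic e k ⟩
    x                            ∎

  iter-reaches : ∀ {p x} → iter f (suc p) x ≡ x → ∀ k j → iter f (j + k * p) (iter f k x) ≡ iter f j x
  iter-reaches {p} {x} e k j = trans (iter-+ j (k * p) (iter f k x)) (cong (iter f j) (iter-return e k))

  trajectory : ℕ → X → List X
  trajectory zero    x = []
  trajectory (suc ℓ) x = x ∷ trajectory ℓ (f x)

  trajectory-++ : ∀ m k x → trajectory (m + k) x ≡ trajectory m x ++ trajectory k (iter f m x)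
  trajectory-++ zero    k x = refl
  trajectory-++ (suc m) k x = cong (x ∷_) (begin
    trajectory (m + k) (f x)                          ≡⟨ trajectory-++ m k (f x) ⟩
    trajectory m (f x) ++ trajectory k (iter f m (f x))
      ≡⟨ cong (λ y → trajectory m (f x) ++ trajectory k y) (iter-comm m x) ⟩
    trajectory m (f x) ++ trajectory k (f (iter f m x)) ∎)

  ∈-trajectory⁺ : ∀ {t ℓ} x → t < ℓ → iter f t x ∈ trajectory ℓ x
  ∈-trajectory⁺ {zero}  {suc ℓ} x _ = here refl
  ∈-trajectory⁺ {suc t} {suc ℓ} x (s<s t<ℓ) =
    there (subst (_∈ trajectory ℓ (f x)) (iter-comm t x) (∈-trajectory⁺ (f x) t<ℓ))

  ∈-trajectory⁻ : ∀ {ℓ x y} → y ∈ trajectory ℓ x → ∃[ t ] t < ℓ × iter f t x ≡ y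
  ∈-trajectory⁻ {suc ℓ} (here refl) = 0 , z<s , refl
  ∈-trajectory⁻ {suc ℓ} {x} (there y∈) with ∈-trajectory⁻ y∈
  ... | t , t<ℓ , e = suc t , s<s t<ℓ , trans (sym (iter-comm t x)) e

  iter-∈-trajectory : ∀ {p x} → iter f (suc p) x ≡ x → ∀ k → iter f k x ∈ trajectory (suc p) x
  iter-∈-trajectory {p} {x} e k =
    subst (_∈ trajectory (suc p) x) (sym (iter-mod e k)) (∈-trajectory⁺ x (m%n<n k (suc p)))

  record Walk (ℓ : ℕ) (x : X) (xs : List X) (y : X) : Set where
    constructor walk
    field
      visits  : trajectory ℓ x ≡ xs
      arrives : iter f ℓ x ≡ y

  walk-step : ∀ x → Walk 1 x [ x ] (f x)
  walk-step x = walk refl refl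

  walk-++ : ∀ {ℓ₁ ℓ₂ x y z xs ys} → Walk ℓ₁ x xs y → Walk ℓ₂ y ys z →
            Walk (ℓ₁ + ℓ₂) x (xs ++ ys) z
  walk-++ {ℓ₁} {ℓ₂} {x} (walk refl refl) (walk refl refl) =
    walk (trajectory-++ ℓ₁ ℓ₂ x) (trans (cong (λ j → iter f j x) (+-comm ℓ₁ ℓ₂)) (iter-+ ℓ₂ ℓ₁ x))

  walk-to : ∀ {ℓ x xs y z} → Walk ℓ x xs y → y ≡ z → Walk ℓ x xs z
  walk-to w refl = w

  MinimalPeriod : ℕ → X → Set
  MinimalPeriod p x = (0 < p) × (iter f p x ≡ x) × (∀ k → 0 < k → k < p → iter f k x ≢ x)

  minimalPeriod-unique : ∀ {p q x} → MinimalPeriod p x → MinimalPeriod q x → p ≡ q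
  minimalPeriod-unique {p} {q} (p>0 , p-per , p-min) (q>0 , q-per , q-min) with <-cmp p q
  ... | tri< p<q _ _ = ⊥-elim (q-min p p>0 p<q p-per)
  ... | tri≈ _ p≡q _ = p≡q
  ... | tri> _ _ q<p = ⊥-elim (p-min q q>0 q<p q-per)

  minimalPeriod-iter : ∀ {p x} → MinimalPeriod p x → ∀ k → MinimalPeriod p (iter f k x)
  minimalPeriod-iter {suc p} {x} (p>0 , per , min) k = p>0 , per′ , min′
    where
    per′ : iter f (suc p) (iter f k x) ≡ iter f k x
    per′ = trans (iter-swap (suc p) k x) (cong (iter f k) per)

    min′ : ∀ j → 0 < j → j < suc p → iter f j (iter f k x) ≢ iter f k x
    min′ j j>0 j<p e = min j j>0 j<p (begin
      iter f j x                               ≡⟨ cong (iter f j) (iter-return per k) ⟨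
      iter f j (iter f (k * p) (iter f k x))   ≡⟨ iter-swap j (k * p) (iter f k x) ⟩
      iter f (k * p) (iter f j (iter f k x))   ≡⟨ cong (iter f (k * p)) e ⟩
      iter f (k * p) (iter f k x)              ≡⟨ iter-return per k ⟩
      x                                        ∎)

  cycle-minimalPeriod : ∀ {ℓ x ys} → Walk (suc ℓ) x (x ∷ ys) x → x ∉ ys → MinimalPeriod (suc ℓ) x
  cycle-minimalPeriod {ℓ} {x} (walk visits per) x∉ys = z<s , per , returns
    where
    returns : ∀ k → 0 < k → k < suc ℓ → iter f k x ≢ x
    returns (suc k) _ (s<s k<ℓ) e = x∉ys (subst (_∈ _) (trans (iter-comm k x) e)
      (subst (iter f k (f x) ∈_) (∷-injectiveʳ visits) (∈-trajectory⁺ (f x) k<ℓ)))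

  sum-trajectory-iter : ∀ (w : X → ℕ) {p x} → iter f p x ≡ x → ∀ k →
                        sum (map w (trajectory p (iter f k x))) ≡ sum (map w (trajectory p x))
  sum-trajectory-iter w {p} {x} per zero = refl
  sum-trajectory-iter w {p} {x} per (suc k) =
    trans (shift (trans (iter-swap p k x) (cong (iter f k) per))) (sum-trajectory-iter w {p} per k)
    where
    S : X → ℕ
    S y = sum (map w (trajectory p y))

    -- compare the two ways of splitting off one point of the trajectory of length p + 1
    shift : ∀ {y} → iter f p y ≡ y → S (f y) ≡ S y
    shift {y} per-y = +-cancelˡ-≡ (w y) _ _ (begin
      w y + S (f y)                                ≡⟨⟩
      sum (map w (trajectory (suc p) y))           ≡⟨ cong (λ j → sum (map w (trajectory j y))) (+-comm 1 p) ⟩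
      sum (map w (trajectory (p + 1) y))           ≡⟨ cong (sum ∘ map w) (trajectory-++ p 1 y) ⟩
      sum (map w (trajectory p y ++ [ iter f p y ])) ≡⟨ cong sum (map-++ w (trajectory p y) _) ⟩
      sum (map w (trajectory p y) ++ [ w (iter f p y) ]) ≡⟨ sum-++ (map w (trajectory p y)) _ ⟩
      S y + (w (iter f p y) + 0)                   ≡⟨ cong (λ z → S y + (w z + 0)) per-y ⟩
      S y + (w y + 0)                              ≡⟨ cong (S y +_) (+-identityʳ (w y)) ⟩
      S y + w y                                    ≡⟨ +-comm (S y) (w y) ⟩
      w y + S y                                    ∎)

open Iteration

module Semiconjugacy {X Y : Set} (f : X → X) (g : Y → Y) (h : X → Y) (P : X → Set)
  (P-step : ∀ {x} → P x → P (f x)) (commutes : ∀ {x} → P x → g (h x) ≡ h (f x)) where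

  P-iter : ∀ {x} k → P x → P (iter f k x)
  P-iter zero    px = px
  P-iter (suc k) px = P-step (P-iter k px)

  iter-commutes : ∀ {x} k → P x → iter g k (h x) ≡ h (iter f k x)
  iter-commutes zero    px = refl
  iter-commutes (suc k) px = trans (cong g (iter-commutes k px)) (commutes (P-iter k px))

  trajectory-commutes : ∀ {x} ℓ → P x → trajectory g ℓ (h x) ≡ map h (trajectory f ℓ x)
  trajectory-commutes zero    px = refl
  trajectory-commutes {x} (suc ℓ) px =
    cong (h x ∷_) (trans (cong (trajectory g ℓ) (commutes px)) (trajectory-commutes ℓ (P-step px)))

  minimalPeriod-commutes : (∀ {x y} → P x → P y → h x ≡ h y → x ≡ y) →
                           ∀ {p x} → P x → MinimalPeriod f p x → MinimalPeriod g p (h x)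
  minimalPeriod-commutes h-inj {p} px (p>0 , per , min) =
    p>0 , trans (iter-commutes p px) (cong h per) ,
    λ k k>0 k<p e → min k k>0 k<p (h-inj (P-iter k px) px (trans (sym (iter-commutes k px)) e))

-- Rowmotion on an arbitrary circular fence

module CircularFenceProperties (α : List ℕ) where
  open CircularFence α

  anyFin-true⁻ : ∀ {p} → anyFin p ≡ true → ∃[ x ] p x ≡ true
  anyFin-true⁻ {p} e with satisfied (any⁻ p (allFin n) (≡⇒T e))
  ... | x , px = x , T⇒≡ px

  anyFin-true⁺ : ∀ {p} x → p x ≡ true → anyFin p ≡ true
  anyFin-true⁺ {p} x px = T⇒≡ (any⁺ p (lose (∈-allFin x) (≡⇒T px)))

  allFin?-true⁻ : ∀ {p} → allFin? p ≡ true → ∀ x → p x ≡ true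
  allFin?-true⁻ {p} e x = T⇒≡ (All.lookup (all⁺ p (allFin n) (≡⇒T e)) (∈-allFin x))

  allFin?-true⁺ : ∀ {p} → (∀ x → p x ≡ true) → allFin? p ≡ true
  allFin?-true⁺ {p} all-p = T⇒≡ (all⁻ p {allFin n} (All.tabulate λ {x} _ → ≡⇒T (all-p x)))

  isNext-true⁻ : ∀ {i j} → isNext i j ≡ true → j ≡ suc i ⊎ (suc i ≡ n × j ≡ 0)
  isNext-true⁻ {i} {j} e with ∨-true⁻ {suc i ≡ᵇ j} e
  ... | inj₁ e₁ = inj₁ (sym (≡ᵇ⇒≡ (suc i) j (≡⇒T e₁)))
  ... | inj₂ e₂ with ∧-true⁻ {suc i ≡ᵇ n} e₂
  ...   | e₃ , e₄ = inj₂ (≡ᵇ⇒≡ (suc i) n (≡⇒T e₃) , ≡ᵇ⇒≡ j 0 (≡⇒T e₄))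

  stepDown-lookup : ∀ S x → lookup (stepDown S) x ≡ (lookup S x ∨ anyFin (λ z → lookup S z ∧ cov x z))
  stepDown-lookup S x = lookup∘tabulate _ x

  -- x lies in the j-th closure step of ⁅ y ⁆; leq x y ≡ true unfolds to Reach n x y
  record Reach (j : ℕ) (x y : Fin n) : Set where
    constructor reach
    field reached : lookup (iter stepDown j ⁅ y ⁆) x ≡ true

  open Reach public

  reach-refl : ∀ y → Reach 0 y y
  reach-refl y = reach ([]=⇒lookup (x∈⁅x⁆ y))

  reach-suc : ∀ {j x y} → Reach j x y → Reach (suc j) x y
  reach-suc {j} {x} {y} (reach r) =
    reach (trans (stepDown-lookup (iter stepDown j ⁅ y ⁆) x)
                 (cong (_∨ anyFin (λ z → lookup (iter stepDown j ⁅ y ⁆) z ∧ cov x z)) r))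

  reach-cov : ∀ {j x z y} → cov x z ≡ true → Reach j z y → Reach (suc j) x y
  reach-cov {j} {x} {z} {y} c (reach r) = reach (trans (stepDown-lookup (iter stepDown j ⁅ y ⁆) x)
    (trans (cong (lookup (iter stepDown j ⁅ y ⁆) x ∨_) (anyFin-true⁺ z (cong₂ _∧_ r c))) (∨-zeroʳ _)))

  reach-+ : ∀ d {j x y} → Reach j x y → Reach (d + j) x y
  reach-+ zero    r = r
  reach-+ (suc d) r = reach-suc (reach-+ d r)

  reach-≤ : ∀ {j k x y} → j ≤ k → Reach j x y → Reach k x y
  reach-≤ {j} {k} {x} {y} j≤k r = subst (λ i → Reach i x y) (m∸n+n≡m j≤k) (reach-+ (k ∸ j) r)

  reach-ind : (R : Fin n → Fin n → Set) → (∀ y → R y y) → (∀ {x z y} → cov x z ≡ true → R z y → R x y) →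
              ∀ j {x y} → Reach j x y → R x y
  reach-ind R R-refl R-cov zero {x} {y} (reach r) =
    subst (λ z → R z y) (sym (x∈⁅y⁆⇒x≡y y (lookup⇒[]= x _ r))) (R-refl y)
  reach-ind R R-refl R-cov (suc j) {x} {y} (reach r)
    with ∨-true⁻ {lookup (iter stepDown j ⁅ y ⁆) x} (trans (sym (stepDown-lookup (iter stepDown j ⁅ y ⁆) x)) r)
  ... | inj₁ r′ = reach-ind R R-refl R-cov j (reach r′)
  ... | inj₂ some with anyFin-true⁻ some
  ...   | z , below with ∧-true⁻ {lookup (iter stepDown j ⁅ y ⁆) z} below
  ...     | r′ , c = R-cov c (reach-ind R R-refl R-cov j (reach r′))

  minCompl-true⁻ : ∀ I m → minCompl I m ≡ true →
                   lookup I m ≡ false × (∀ x → leq x m ≡ true → x ≡ m ⊎ lookup I x ≡ true)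
  minCompl-true⁻ I m e with ∧-true⁻ {not (lookup I m)} e
  ... | m∉I , below = not-true⁻ m∉I , inside
    where
    inside : ∀ x → leq x m ≡ true → x ≡ m ⊎ lookup I x ≡ true
    inside x x≤m with allFin?-true⁻ below x
    ... | holds rewrite x≤m with x ≟ᶠ m
    ...   | yes x≡m = inj₁ x≡m
    ...   | no  _   = inj₂ holds

  minCompl-true⁺ : ∀ I m → lookup I m ≡ false → (∀ x → leq x m ≡ true → x ≡ m ⊎ lookup I x ≡ true) →
                   minCompl I m ≡ true
  minCompl-true⁺ I m m∉I inside rewrite m∉I = allFin?-true⁺ holds
    where
    holds : ∀ x → (not (leq x m) ∨ ⌊ x ≟ᶠ m ⌋ ∨ lookup I x) ≡ true
    holds x with leq x m in x≤m
    ... | false = refl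
    ... | true with x ≟ᶠ m | inside x x≤m
    ...   | yes _ | _        = refl
    ...   | no  _ | inj₂ x∈I = x∈I
    ...   | no x≢m | inj₁ x≡m = ⊥-elim (x≢m x≡m)

  row-true⁻ : ∀ I x → lookup (row I) x ≡ true → ∃[ m ] minCompl I m ≡ true × leq x m ≡ true
  row-true⁻ I x e with anyFin-true⁻ (trans (sym (lookup∘tabulate _ x)) e)
  ... | m , w = m , ∧-true⁻ w

  row-true⁺ : ∀ I x m → minCompl I m ≡ true → leq x m ≡ true → lookup (row I) x ≡ true
  row-true⁺ I x m min x≤m = trans (lookup∘tabulate _ x) (anyFin-true⁺ m (cong₂ _∧_ min x≤m))

  -- the membership of the element with index i (false if there is none)
  lookupℕ : Subset n → ℕ → Bool
  lookupℕ I i with i <? n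
  ... | yes i<n = lookup I (fromℕ< i<n)
  ... | no  _   = false

  lookupℕ-toℕ : ∀ I x → lookupℕ I (toℕ x) ≡ lookup I x
  lookupℕ-toℕ I x with toℕ x <? n
  ... | yes x<n = cong (lookup I) (fromℕ<-toℕ x x<n)
  ... | no  x≮n = ⊥-elim (x≮n (toℕ<n x))

  chi-trajectory : ∀ I p → chi I p ≡ sum (map ∣_∣ (trajectory row p I))
  chi-trajectory I zero    = refl
  chi-trajectory I (suc p) = cong (∣ I ∣ +_) (chi-trajectory (row I) p)

  SingleOrbit : ℕ → Set
  SingleOrbit p = ∀ I → IsIdeal I → IsPeriod I p × (∀ J → IsIdeal J → InOrbit I J)

  singleOrbit⇒homomesic : ∀ N → SingleOrbit N → Homomesic
  singleOrbit⇒homomesic N orbit I J p q I-ideal J-ideal I-period J-period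
    with minimalPeriod-unique row I-period (proj₁ (orbit I I-ideal))
       | minimalPeriod-unique row J-period (proj₁ (orbit J J-ideal))
       | proj₂ (orbit I I-ideal) J J-ideal
  ... | refl | refl | k , refl = cong (_* N) (begin
    chi I N                                      ≡⟨ chi-trajectory I N ⟩
    sum (map ∣_∣ (trajectory row N I))           ≡⟨ sum-trajectory-iter row ∣_∣ {N} (proj₁ (proj₂ I-period)) k ⟨
    sum (map ∣_∣ (trajectory row N (iter row k I))) ≡⟨ chi-trajectory (iter row k I) N ⟨
    chi (iter row k I) N                         ∎)

-- The fence F̄(a, 1, 1, 1), for a = suc m

module FenceA111 (m : ℕ) where

  a : ℕ
  a = suc m

  open CircularFence (fenceA111 a)
  open CircularFenceProperties (fenceA111 a)

  n≡3+a : n ≡ 3 + a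
  n≡3+a = +-comm a 3

  -- chain i is x_{i+1}, so x_1 ≺ ⋯ ≺ x_{a+1} is chain 0 ≺ ⋯ ≺ chain a; valley = x_{a+2} lies
  -- below chain a and below peak = x_{a+3}, which also lies above chain 0
  data Point : Set where
    chain       : ℕ → Point
    valley peak : Point

  InRange : Point → Set
  InRange (chain i) = i ≤ a
  InRange valley    = ⊤
  InRange peak      = ⊤

  index : Point → ℕ
  index (chain i) = i
  index valley    = suc a
  index peak      = suc (suc a)

  point : ℕ → Point
  point i = if i <ᵇ suc a then chain i else if i <ᵇ suc (suc a) then valley else peak

  point-chain : ∀ {i} → i ≤ a → point i ≡ chain i
  point-chain i≤a rewrite <ᵇ-true (s≤s i≤a) = refl

  point-valley : point (suc a) ≡ valley
  point-valley rewrite <ᵇ-false (≤-refl {suc a}) | <ᵇ-true (n<1+n (suc a)) = refl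

  point-peak : point (suc (suc a)) ≡ peak
  point-peak rewrite <ᵇ-false (n≤1+n (suc a)) | <ᵇ-false (≤-refl {suc (suc a)}) = refl

  data IndexView : ℕ → Set where
    chain-index  : ∀ {i} → i ≤ a → IndexView i
    valley-index : IndexView (suc a)
    peak-index   : IndexView (suc (suc a))

  indexView : ∀ {i} → i < n → IndexView i
  indexView {i} i<n with i ≤? a
  ... | yes i≤a = chain-index i≤a
  ... | no  i≰a with suc a ≟ i
  ...   | yes refl = valley-index
  ...   | no  i≢1+a with suc (suc a) ≟ i
  ...     | yes refl = peak-index
  ...     | no  i≢2+a =
    ⊥-elim (<⇒≱ (subst (i <_) n≡3+a i<n) (≤∧≢⇒< (≤∧≢⇒< (≰⇒> i≰a) i≢1+a) i≢2+a))

  index<n : ∀ {e} → InRange e → index e < n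
  index<n {chain i} i≤a = subst (i <_) (sym n≡3+a) (m≤n⇒m≤1+n (m≤n⇒m≤1+n (s≤s i≤a)))
  index<n {valley}  _   = subst (suc a <_) (sym n≡3+a) (m≤n⇒m≤1+n (n<1+n (suc a)))
  index<n {peak}    _   = subst (suc (suc a) <_) (sym n≡3+a) (n<1+n (suc (suc a)))

  point-index : ∀ {e} → InRange e → point (index e) ≡ e
  point-index {chain i} i≤a = point-chain i≤a
  point-index {valley}  _   = point-valley
  point-index {peak}    _   = point-peak

  index-point : ∀ {i} → i < n → index (point i) ≡ i
  index-point i<n with indexView i<n
  ... | chain-index i≤a = cong index (point-chain i≤a)
  ... | valley-index    = cong index point-valley
  ... | peak-index      = cong index point-peak

  point-inRange : ∀ {i} → i < n → InRange (point i)
  point-inRange i<n with indexView i<n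
  ... | chain-index i≤a = subst InRange (sym (point-chain i≤a)) i≤a
  ... | valley-index    = subst InRange (sym point-valley) tt
  ... | peak-index      = subst InRange (sym point-peak) tt

  el : Fin n → Point
  el x = point (toℕ x)

  el-inRange : ∀ x → InRange (el x)
  el-inRange x = point-inRange (toℕ<n x)

  index-el : ∀ x → index (el x) ≡ toℕ x
  index-el x = index-point (toℕ<n x)

  el-injective : ∀ {x y} → el x ≡ el y → x ≡ y
  el-injective {x} {y} e = toℕ-injective (trans (sym (index-el x)) (trans (cong index e) (index-el y)))

  fin : ∀ e → InRange e → Fin n
  fin e r = fromℕ< (index<n r)

  el-fin : ∀ {e} (r : InRange e) → el (fin e r) ≡ e
  el-fin r = trans (cong point (toℕ-fromℕ< (index<n r))) (point-index r)

  up-chain : ∀ {i} → i < a → up (fenceA111 a) i ≡ true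
  up-chain i<a rewrite <ᵇ-true i<a = refl

  up-top : up (fenceA111 a) a ≡ false
  up-top rewrite <ᵇ-false (≤-refl {a}) | n∸n≡0 a = refl

  up-valley : up (fenceA111 a) (suc a) ≡ true
  up-valley rewrite <ᵇ-false (n≤1+n a) | m+n∸n≡m 1 a = refl

  up-peak : up (fenceA111 a) (suc (suc a)) ≡ false
  up-peak rewrite <ᵇ-false (≤-trans (n≤1+n a) (n≤1+n (suc a))) | m+n∸n≡m 2 a = refl

  -- cov x y unfolds to covᴺ (toℕ x) (toℕ y)
  covᴺ : ℕ → ℕ → Bool
  covᴺ i j = (up (fenceA111 a) i ∧ isNext i j) ∨ (not (up (fenceA111 a) j) ∧ isNext j i)

  data _⋖_ : Point → Point → Set where
    chain⋖chain  : ∀ {i} → i < a → chain i ⋖ chain (suc i)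
    valley⋖chain : valley ⋖ chain a
    valley⋖peak  : valley ⋖ peak
    chain⋖peak   : chain 0 ⋖ peak

  2+a<n : suc (suc a) < n
  2+a<n = subst (suc (suc a) <_) (sym n≡3+a) (n<1+n (suc (suc a)))

  up-true⁻ : ∀ {i} → i < n → up (fenceA111 a) i ≡ true → i < a ⊎ i ≡ suc a
  up-true⁻ i<n e with indexView i<n
  ... | valley-index = inj₂ refl
  ... | peak-index   = ⊥-elim (true⇒≢false e up-peak)
  ... | chain-index i≤a with m≤n⇒m<n∨m≡n i≤a
  ...   | inj₁ i<a  = inj₁ i<a
  ...   | inj₂ refl = ⊥-elim (true⇒≢false e up-top)

  up-false⁻ : ∀ {i} → i < n → up (fenceA111 a) i ≡ false → i ≡ a ⊎ i ≡ suc (suc a)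
  up-false⁻ i<n e with indexView i<n
  ... | valley-index = ⊥-elim (true⇒≢false up-valley e)
  ... | peak-index   = inj₂ refl
  ... | chain-index i≤a with m≤n⇒m<n∨m≡n i≤a
  ...   | inj₁ i<a  = ⊥-elim (true⇒≢false (up-chain i<a) e)
  ...   | inj₂ refl = inj₁ refl

  no-wrap : ∀ {i} → i ≤ suc a → suc i ≢ n
  no-wrap i≤1+a = <⇒≢ (≤-<-trans (s≤s i≤1+a) 2+a<n)

  upStep-sound : ∀ {i j} → i < n → up (fenceA111 a) i ≡ true → isNext i j ≡ true → point i ⋖ point j
  upStep-sound {i} {j} i<n i-up i→j with up-true⁻ i<n i-up | isNext-true⁻ {i} {j} i→j
  ... | inj₁ i<a  | inj₁ refl = subst₂ _⋖_ (sym (point-chain (<⇒≤ i<a))) (sym (point-chain i<a)) (chain⋖chain i<a)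
  ... | inj₂ refl | inj₁ refl = subst₂ _⋖_ (sym point-valley) (sym point-peak) valley⋖peak
  ... | inj₁ i<a  | inj₂ (wrap , _) = ⊥-elim (no-wrap (≤-trans (<⇒≤ i<a) (n≤1+n a)) wrap)
  ... | inj₂ refl | inj₂ (wrap , _) = ⊥-elim (no-wrap ≤-refl wrap)

  downStep-sound : ∀ {i j} → i < n → j < n → up (fenceA111 a) j ≡ false → isNext j i ≡ true → point i ⋖ point j
  downStep-sound {i} {j} i<n j<n j-down j→i with up-false⁻ j<n j-down | isNext-true⁻ {j} {i} j→i
  ... | inj₁ refl | inj₁ refl = subst₂ _⋖_ (sym point-valley) (sym (point-chain ≤-refl)) valley⋖chain
  ... | inj₂ refl | inj₂ (_ , refl) = subst₂ _⋖_ (sym (point-chain z≤n)) (sym point-peak) chain⋖peak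
  ... | inj₁ refl | inj₂ (wrap , _) = ⊥-elim (no-wrap (n≤1+n a) wrap)
  ... | inj₂ refl | inj₁ refl = ⊥-elim (<-irrefl (sym n≡3+a) i<n)

  covᴺ-sound : ∀ {i j} → i < n → j < n → covᴺ i j ≡ true → point i ⋖ point j
  covᴺ-sound {i} {j} i<n j<n e with ∨-true⁻ {up (fenceA111 a) i ∧ isNext i j} e
  ... | inj₁ e₁ = let i-up , i→j = ∧-true⁻ {up (fenceA111 a) i} e₁ in upStep-sound {i} {j} i<n i-up i→j
  ... | inj₂ e₂ = let j-down , j→i = ∧-true⁻ {not (up (fenceA111 a) j)} e₂ in
                  downStep-sound {i} {j} i<n j<n (not-true⁻ j-down) j→i

  covᴺ-complete : ∀ {e f} → e ⋖ f → covᴺ (index e) (index f) ≡ true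
  covᴺ-complete (chain⋖chain {i} i<a) rewrite up-chain i<a | ≡ᵇ-refl i = refl
  covᴺ-complete valley⋖chain rewrite up-top | ≡ᵇ-refl a = ∨-zeroʳ _
  covᴺ-complete valley⋖peak rewrite up-valley | ≡ᵇ-refl a = refl
  covᴺ-complete chain⋖peak rewrite up-peak | T⇒≡ (≡⇒≡ᵇ (3 + a) n (sym n≡3+a)) = ∨-zeroʳ _

  cov-sound : ∀ {x y} → cov x y ≡ true → el x ⋖ el y
  cov-sound {x} {y} = covᴺ-sound (toℕ<n x) (toℕ<n y)

  cov-complete : ∀ {e f x y} → e ⋖ f → el x ≡ e → el y ≡ f → cov x y ≡ true
  cov-complete {x = x} {y} e⋖f refl refl =
    subst₂ (λ i j → covᴺ i j ≡ true) (index-el x) (index-el y) (covᴺ-complete e⋖f)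

  data _≼_ : Point → Point → Set where
    chain≼chain   : ∀ {i j} → i ≤ j → j ≤ a → chain i ≼ chain j
    valley≼chain  : valley ≼ chain a
    valley≼valley : valley ≼ valley
    valley≼peak   : valley ≼ peak
    peak≼peak     : peak ≼ peak
    chain≼peak    : chain 0 ≼ peak

  ≼-refl : ∀ {e} → InRange e → e ≼ e
  ≼-refl {chain i} i≤a = chain≼chain ≤-refl i≤a
  ≼-refl {valley}  _   = valley≼valley
  ≼-refl {peak}    _   = peak≼peak

  ⋖-≼-trans : ∀ {e f g} → e ⋖ f → f ≼ g → e ≼ g
  ⋖-≼-trans (chain⋖chain {i} _) (chain≼chain i+1≤j j≤a) = chain≼chain (≤-trans (n≤1+n i) i+1≤j) j≤a
  ⋖-≼-trans valley⋖chain (chain≼chain a≤j j≤a) with ≤-antisym a≤j j≤a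
  ... | refl = valley≼chain
  ⋖-≼-trans valley⋖peak peak≼peak = valley≼peak
  ⋖-≼-trans chain⋖peak  peak≼peak = chain≼peak

  leq-sound : ∀ x y → leq x y ≡ true → el x ≼ el y
  leq-sound x y x≤y = reach-ind (λ x y → el x ≼ el y) (λ y → ≼-refl (el-inRange y))
                         (λ {x} {z} c r → ⋖-≼-trans (cov-sound {x} {z} c) r) n {x} {y} (reach x≤y)

  reach-chain : ∀ d {i x y} → i + d ≤ a → el x ≡ chain i → el y ≡ chain (i + d) → Reach d x y
  reach-chain zero {i} {x} {y} _ ex ey =
    subst (λ z → Reach 0 z y) (el-injective (trans ey (trans (cong chain (+-identityʳ i)) (sym ex)))) (reach-refl y)
  reach-chain (suc d) {i} {x} {y} i+d+1≤a ex ey =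
    reach-cov (cov-complete {x = x} {z} (chain⋖chain i<a) ex (el-fin i+1≤a))
              (reach-chain d {suc i} {z} {y} (subst (_≤ a) (+-suc i d) i+d+1≤a) (el-fin i+1≤a)
                           (trans ey (cong chain (+-suc i d))))
    where
    i+1≤a : suc i ≤ a
    i+1≤a = ≤-trans (s≤s (m≤m+n i d)) (subst (_≤ a) (+-suc i d) i+d+1≤a)
    i<a : i < a
    i<a = i+1≤a
    z : Fin n
    z = fin (chain (suc i)) i+1≤a

  reach-step : ∀ {e f x y} → e ⋖ f → el x ≡ e → el y ≡ f → Reach 1 x y
  reach-step {x = x} {y} e⋖f ex ey = reach-cov (cov-complete {x = x} {y} e⋖f ex ey) (reach-refl y)

  leq-complete : ∀ x y → el x ≼ el y → leq x y ≡ true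
  leq-complete x y x≼y = reached (go x≼y refl refl)
    where
    1≤n : 1 ≤ n
    1≤n = ≤-trans (s≤s z≤n) (<⇒≤ 2+a<n)

    same : ∀ {e} → el x ≡ e → el y ≡ e → Reach n x y
    same ex ey = reach-≤ {0} z≤n (subst (λ z → Reach 0 z y) (el-injective (trans ey (sym ex))) (reach-refl y))

    go : ∀ {e f} → e ≼ f → el x ≡ e → el y ≡ f → Reach n x y
    go (chain≼chain {i} {j} i≤j j≤a) ex ey =
      reach-≤ (≤-trans (m∸n≤m j i) (≤-trans j≤a (<⇒≤ (index<n {chain a} ≤-refl))))
        (reach-chain (j ∸ i) (subst (_≤ a) (sym (m+[n∸m]≡n i≤j)) j≤a) ex
                     (trans ey (cong chain (sym (m+[n∸m]≡n i≤j)))))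
    go valley≼chain  ex ey = reach-≤ 1≤n (reach-step valley⋖chain ex ey)
    go valley≼peak   ex ey = reach-≤ 1≤n (reach-step valley⋖peak ex ey)
    go chain≼peak    ex ey = reach-≤ 1≤n (reach-step chain⋖peak ex ey)
    go valley≼valley ex ey = same ex ey
    go peak≼peak     ex ey = same ex ey

  subset : (Point → Bool) → Subset n
  subset P = tabulate (P ∘ el)

  lookup-subset : ∀ P x → lookup (subset P) x ≡ P (el x)
  lookup-subset P x = lookup∘tabulate (P ∘ el) x

  subset-ext : ∀ {S} P → (∀ x → lookup S x ≡ P (el x)) → S ≡ subset P
  subset-ext {S} P agree = trans (sym (tabulate∘lookup S)) (tabulate-cong agree)

  MinimalOutside : (Point → Bool) → Point → Set
  MinimalOutside P e = P e ≡ false × (∀ {e′} → InRange e′ → e′ ≼ e → e′ ≡ e ⊎ P e′ ≡ true)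

  minCompl-subset⁻ : ∀ P x → minCompl (subset P) x ≡ true → MinimalOutside P (el x)
  minCompl-subset⁻ P x min with minCompl-true⁻ (subset P) x min
  ... | x∉ , below = trans (sym (lookup-subset P x)) x∉ , outside
    where
    outside : ∀ {e′} → InRange e′ → e′ ≼ el x → e′ ≡ el x ⊎ P e′ ≡ true
    outside {e′} r e′≼x with below (fin e′ r) (leq-complete (fin e′ r) x (subst (_≼ el x) (sym (el-fin r)) e′≼x))
    ... | inj₁ refl = inj₁ (sym (el-fin r))
    ... | inj₂ y∈   = inj₂ (trans (sym (cong P (el-fin r))) (trans (sym (lookup-subset P (fin e′ r))) y∈))

  minCompl-subset⁺ : ∀ P x → MinimalOutside P (el x) → minCompl (subset P) x ≡ true
  minCompl-subset⁺ P x (x∉ , outside) = minCompl-true⁺ (subset P) x (trans (lookup-subset P x) x∉) below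
    where
    below : ∀ y → leq y x ≡ true → y ≡ x ⊎ lookup (subset P) y ≡ true
    below y y≤x with outside (el-inRange y) (leq-sound y x y≤x)
    ... | inj₁ same = inj₁ (el-injective same)
    ... | inj₂ y∈   = inj₂ (trans (lookup-subset P y) y∈)

  row-subset⁻ : ∀ P x → lookup (row (subset P)) x ≡ true → ∃[ e ] InRange e × MinimalOutside P e × el x ≼ e
  row-subset⁻ P x x∈ =
    let y , min , x≤y = row-true⁻ (subset P) x x∈ in el y , el-inRange y , minCompl-subset⁻ P y min , leq-sound x y x≤y

  row-subset⁺ : ∀ P x {e} (r : InRange e) → MinimalOutside P e → el x ≼ e → lookup (row (subset P)) x ≡ true
  row-subset⁺ P x {e} r min x≼e =
    row-true⁺ (subset P) x (fin e r) (minCompl-subset⁺ P (fin e r) (subst (MinimalOutside P) (sym (el-fin r)) min))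
              (leq-complete x (fin e r) (subst (el x ≼_) (sym (el-fin r)) x≼e))

  -- Below the top of the chain, rowmotion adds one chain element and moves (valley, peak) through
  -- out/out → in/out → in/in → out/out; the phases A, B, C are these three stages.
  data Phase : Set where
    A B C : Phase

  next : Phase → Phase
  next A = B
  next B = C
  next C = A

  State : Set
  State = Phase × ℕ

  contains : State → Point → Bool
  contains (L , K) (chain i) = i <ᵇ K
  contains (A , K) valley    = a <ᵇ K
  contains (A , K) peak      = false
  contains (B , K) valley    = true
  contains (B , K) peak      = false
  contains (C , K) valley    = true
  contains (C , K) peak      = 0 <ᵇ K

  ideal : State → Subset n
  ideal s = subset (contains s)

  data Valid : State → Set where
    valid-A : ∀ {K} → K ≤ suc a → Valid (A , K)
    valid-B : ∀ {K} → 0 < K → K ≤ a → Valid (B , K)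
    valid-C : ∀ {K} → K ≤ suc a → Valid (C , K)

  top : Phase → State
  top A = C , 0
  top B = C , suc a
  top C = A , suc a

  -- only A and C occur with K = suc a
  overflow : Phase → State
  overflow A = C , 1
  overflow _ = A , 0

  F : State → State
  F (L , K) = if K <ᵇ a then (next L , suc K) else if K <ᵇ suc a then top L else overflow L

  F-below : ∀ L {K} → K < a → F (L , K) ≡ (next L , suc K)
  F-below L K<a rewrite <ᵇ-true K<a = refl

  F-top : ∀ L → F (L , a) ≡ top L
  F-top L rewrite <ᵇ-false (≤-refl {a}) | <ᵇ-true (n<1+n a) = refl

  F-overflow : ∀ L → F (L , suc a) ≡ overflow L
  F-overflow L rewrite <ᵇ-false (n≤1+n a) | <ᵇ-false (≤-refl {suc a}) = refl

  data StateView : State → Set where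
    below-A    : ∀ {K} → K < a → StateView (A , K)
    below-B    : ∀ {K} → 0 < K → K < a → StateView (B , K)
    below-C    : ∀ {K} → K < a → StateView (C , K)
    at-top     : ∀ L → StateView (L , a)
    overflow-A : StateView (A , suc a)
    overflow-C : StateView (C , suc a)

  stateView : ∀ {s} → Valid s → StateView s
  stateView {L , K} v with <-cmp K a
  stateView {A , K} _                 | tri< K<a _ _  = below-A K<a
  stateView {B , K} (valid-B K>0 _)   | tri< K<a _ _  = below-B K>0 K<a
  stateView {C , K} _                 | tri< K<a _ _  = below-C K<a
  stateView {L , K} _                 | tri≈ _ refl _ = at-top L
  stateView {B , K} (valid-B _ K≤a)   | tri> _ _ a<K  = ⊥-elim (<⇒≱ a<K K≤a)
  stateView {A , K} (valid-A K≤1+a)   | tri> _ _ a<K with ≤-antisym K≤1+a a<K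
  ... | refl = overflow-A
  stateView {C , K} (valid-C K≤1+a)   | tri> _ _ a<K with ≤-antisym K≤1+a a<K
  ... | refl = overflow-C

  F-valid : ∀ {s} → Valid s → Valid (F s)
  F-valid v with stateView v
  ... | below-A {K} K<a rewrite F-below A K<a = valid-B (s≤s z≤n) K<a
  ... | below-B {K} _ K<a rewrite F-below B K<a = valid-C (s≤s (<⇒≤ K<a))
  ... | below-C {K} K<a rewrite F-below C K<a = valid-A (s≤s (<⇒≤ K<a))
  ... | at-top A rewrite F-top A = valid-C z≤n
  ... | at-top B rewrite F-top B = valid-C ≤-refl
  ... | at-top C rewrite F-top C = valid-A ≤-refl
  ... | overflow-A rewrite F-overflow A = valid-C (s≤s z≤n)
  ... | overflow-C rewrite F-overflow C = valid-A z≤n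

  data Minimal : State → Point → Set where
    chain-min  : ∀ {L K} → K ≤ a → K < a ⊎ contains (L , K) valley ≡ true → Minimal (L , K) (chain K)
    valley-min : ∀ {s} → contains s valley ≡ false → Minimal s valley
    peak-min   : ∀ {L K} → 0 < K → contains (L , K) valley ≡ true → contains (L , K) peak ≡ false →
                 Minimal (L , K) peak

  minimal-inRange : ∀ {s e} → Minimal s e → InRange e
  minimal-inRange (chain-min K≤a _) = K≤a
  minimal-inRange (valley-min _)    = tt
  minimal-inRange (peak-min _ _ _)  = tt

  minimal⇒minimalOutside : ∀ {s e} → Minimal s e → MinimalOutside (contains s) e
  minimal⇒minimalOutside (chain-min {L} {K} _ K<a⊎valley) = <ᵇ-false (≤-refl {K}) , below
    where
    below : ∀ {e′} → InRange e′ → e′ ≼ chain K → e′ ≡ chain K ⊎ contains (L , K) e′ ≡ true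
    below _ (chain≼chain {i} i≤K _) with m≤n⇒m<n∨m≡n i≤K
    ... | inj₁ i<K  = inj₂ (<ᵇ-true i<K)
    ... | inj₂ refl = inj₁ refl
    below _ valley≼chain = inj₂ (valley-in K<a⊎valley)
      where
      valley-in : a < a ⊎ contains (L , a) valley ≡ true → contains (L , a) valley ≡ true
      valley-in (inj₁ a<a) = ⊥-elim (<-irrefl refl a<a)
      valley-in (inj₂ v∈)  = v∈
  minimal⇒minimalOutside (valley-min valley∉) = valley∉ , λ { _ valley≼valley → inj₁ refl }
  minimal⇒minimalOutside (peak-min {L} {K} K>0 valley∈ peak∉) = peak∉ , below
    where
    below : ∀ {e′} → InRange e′ → e′ ≼ peak → e′ ≡ peak ⊎ contains (L , K) e′ ≡ true
    below _ peak≼peak   = inj₁ refl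
    below _ valley≼peak = inj₂ valley∈
    below _ chain≼peak  = inj₂ (<ᵇ-true K>0)

  minimalOutside⇒minimal : ∀ {s e} → InRange e → MinimalOutside (contains s) e → Minimal s e
  minimalOutside⇒minimal {L , K} {chain j} j≤a (j∉ , below) with <-cmp K j
  ... | tri< K<j _ _ with below {chain K} (≤-trans (<⇒≤ K<j) j≤a) (chain≼chain (<⇒≤ K<j) j≤a)
  ...   | inj₁ refl = ⊥-elim (<-irrefl refl K<j)
  ...   | inj₂ K<K  = ⊥-elim (true⇒≢false K<K (<ᵇ-false (≤-refl {K})))
  minimalOutside⇒minimal {L , K} {chain j} j≤a (j∉ , below) | tri> _ _ j<K =
    ⊥-elim (true⇒≢false (<ᵇ-true j<K) j∉)
  minimalOutside⇒minimal {L , K} {chain K} K≤a (_ , below) | tri≈ _ refl _ with m≤n⇒m<n∨m≡n K≤a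
  ... | inj₁ K<a  = chain-min K≤a (inj₁ K<a)
  ... | inj₂ refl with below {valley} tt valley≼chain
  ...   | inj₂ valley∈ = chain-min K≤a (inj₂ valley∈)
  minimalOutside⇒minimal {s} {valley} _ (valley∉ , _) = valley-min valley∉
  minimalOutside⇒minimal {L , K} {peak} _ (peak∉ , below)
    with below {valley} tt valley≼peak | below {chain 0} z≤n chain≼peak
  ... | inj₂ valley∈ | inj₂ 0<K = peak-min (<ᵇ-true⁻ 0<K) valley∈ peak∉

  -- together: ideal t is generated by the minimal elements outside ideal s
  RowSound : State → State → Set
  RowSound s t = ∀ {e f} → Minimal s f → e ≼ f → contains t e ≡ true

  RowComplete : State → State → Set
  RowComplete s t = ∀ {e} → InRange e → contains t e ≡ true → ∃[ f ] Minimal s f × e ≼ f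

  row-ideal : ∀ {s t} → RowSound s t → RowComplete s t → row (ideal s) ≡ ideal t
  row-ideal {s} {t} sound complete = subset-ext (contains t) λ x → ≡true-ext (⊆ x) (⊇ x)
    where
    ⊆ : ∀ x → lookup (row (ideal s)) x ≡ true → contains t (el x) ≡ true
    ⊆ x x∈ = let _ , r , min , x≼f = row-subset⁻ (contains s) x x∈ in sound (minimalOutside⇒minimal r min) x≼f

    ⊇ : ∀ x → contains t (el x) ≡ true → lookup (row (ideal s)) x ≡ true
    ⊇ x x∈ = let _ , min , x≼f = complete (el-inRange x) x∈ in
             row-subset⁺ (contains s) x (minimal-inRange min) (minimal⇒minimalOutside min) x≼f

  a<ᵇ1+a : (a <ᵇ suc a) ≡ true
  a<ᵇ1+a = <ᵇ-true (n<1+n a)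

  rowSound-A : ∀ {K} → K < a → RowSound (A , K) (B , suc K)
  rowSound-A K<a (chain-min _ _) (chain≼chain i≤K _) = <ᵇ-true (s≤s i≤K)
  rowSound-A K<a (chain-min _ _) valley≼chain       = ⊥-elim (<-irrefl refl K<a)
  rowSound-A K<a (valley-min _)  valley≼valley      = refl
  rowSound-A K<a (peak-min _ v∈ _) _                 = ⊥-elim (true⇒≢false v∈ (<ᵇ-false (<⇒≤ K<a)))

  rowComplete-A : ∀ {K} → K < a → RowComplete (A , K) (B , suc K)
  rowComplete-A {K} K<a {chain i} _ i≤K =
    chain K , chain-min (<⇒≤ K<a) (inj₁ K<a) , chain≼chain (s≤s⁻¹ (<ᵇ-true⁻ i≤K)) (<⇒≤ K<a)
  rowComplete-A K<a {valley} _ _ = valley , valley-min (<ᵇ-false (<⇒≤ K<a)) , valley≼valley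
  rowComplete-A K<a {peak}   _ ()

  rowSound-B : ∀ {K} → K < a → RowSound (B , K) (C , suc K)
  rowSound-B K<a (chain-min _ _) (chain≼chain i≤K _) = <ᵇ-true (s≤s i≤K)
  rowSound-B K<a (chain-min _ _) valley≼chain       = ⊥-elim (<-irrefl refl K<a)
  rowSound-B K<a (valley-min ()) _
  rowSound-B K<a (peak-min _ _ _) peak≼peak   = refl
  rowSound-B K<a (peak-min _ _ _) valley≼peak = refl
  rowSound-B K<a (peak-min _ _ _) chain≼peak  = refl

  rowComplete-B : ∀ {K} → 0 < K → K < a → RowComplete (B , K) (C , suc K)
  rowComplete-B {K} K>0 K<a {chain i} _ i≤K =
    chain K , chain-min (<⇒≤ K<a) (inj₁ K<a) , chain≼chain (s≤s⁻¹ (<ᵇ-true⁻ i≤K)) (<⇒≤ K<a)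
  rowComplete-B K>0 K<a {valley} _ _ = peak , peak-min K>0 refl refl , valley≼peak
  rowComplete-B K>0 K<a {peak}   _ _ = peak , peak-min K>0 refl refl , peak≼peak

  rowSound-C : ∀ {K} → K < a → RowSound (C , K) (A , suc K)
  rowSound-C K<a (chain-min _ _) (chain≼chain i≤K _) = <ᵇ-true (s≤s i≤K)
  rowSound-C K<a (chain-min _ _) valley≼chain       = ⊥-elim (<-irrefl refl K<a)
  rowSound-C K<a (valley-min ()) _
  rowSound-C K<a (peak-min (s≤s z≤n) _ ()) _

  rowComplete-C : ∀ {K} → K < a → RowComplete (C , K) (A , suc K)
  rowComplete-C {K} K<a {chain i} _ i≤K =
    chain K , chain-min (<⇒≤ K<a) (inj₁ K<a) , chain≼chain (s≤s⁻¹ (<ᵇ-true⁻ i≤K)) (<⇒≤ K<a)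
  rowComplete-C K<a {valley} _ a≤K = ⊥-elim (<⇒≱ K<a (s≤s⁻¹ (<ᵇ-true⁻ a≤K)))
  rowComplete-C K<a {peak}   _ ()

  rowSound-topA : RowSound (A , a) (C , 0)
  rowSound-topA (chain-min _ (inj₁ a<a)) _ = ⊥-elim (<-irrefl refl a<a)
  rowSound-topA (chain-min _ (inj₂ v∈))  _ = ⊥-elim (true⇒≢false v∈ (<ᵇ-false (≤-refl {a})))
  rowSound-topA (valley-min _) valley≼valley = refl
  rowSound-topA (peak-min _ v∈ _) _ = ⊥-elim (true⇒≢false v∈ (<ᵇ-false (≤-refl {a})))

  rowComplete-topA : RowComplete (A , a) (C , 0)
  rowComplete-topA {chain i} _ ()
  rowComplete-topA {valley}  _ _ = valley , valley-min (<ᵇ-false (≤-refl {a})) , valley≼valley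
  rowComplete-topA {peak}    _ ()

  rowSound-topB : RowSound (B , a) (C , suc a)
  rowSound-topB (chain-min _ _) (chain≼chain i≤a _) = <ᵇ-true (s≤s i≤a)
  rowSound-topB (chain-min _ _) valley≼chain       = refl
  rowSound-topB (valley-min ()) _
  rowSound-topB (peak-min _ _ _) peak≼peak   = refl
  rowSound-topB (peak-min _ _ _) valley≼peak = refl
  rowSound-topB (peak-min _ _ _) chain≼peak  = refl

  rowComplete-topB : RowComplete (B , a) (C , suc a)
  rowComplete-topB {chain i} i≤a _ = chain a , chain-min ≤-refl (inj₂ refl) , chain≼chain i≤a ≤-refl
  rowComplete-topB {valley}  _   _ = chain a , chain-min ≤-refl (inj₂ refl) , valley≼chain
  rowComplete-topB {peak}    _   _ = peak , peak-min (s≤s z≤n) refl refl , peak≼peak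

  rowSound-topC : RowSound (C , a) (A , suc a)
  rowSound-topC (chain-min _ _) (chain≼chain i≤a _) = <ᵇ-true (s≤s i≤a)
  rowSound-topC (chain-min _ _) valley≼chain       = a<ᵇ1+a
  rowSound-topC (valley-min ()) _
  rowSound-topC (peak-min _ _ ()) _

  rowComplete-topC : RowComplete (C , a) (A , suc a)
  rowComplete-topC {chain i} i≤a _ = chain a , chain-min ≤-refl (inj₂ refl) , chain≼chain i≤a ≤-refl
  rowComplete-topC {valley}  _   _ = chain a , chain-min ≤-refl (inj₂ refl) , valley≼chain
  rowComplete-topC {peak}    _   ()

  rowSound-overflowA : RowSound (A , suc a) (C , 1)
  rowSound-overflowA (chain-min 1+a≤a _) _ = ⊥-elim (<-irrefl refl 1+a≤a)
  rowSound-overflowA (valley-min v∉) _     = ⊥-elim (true⇒≢false a<ᵇ1+a v∉)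
  rowSound-overflowA (peak-min _ _ _) peak≼peak   = refl
  rowSound-overflowA (peak-min _ _ _) valley≼peak = refl
  rowSound-overflowA (peak-min _ _ _) chain≼peak  = refl

  rowComplete-overflowA : RowComplete (A , suc a) (C , 1)
  rowComplete-overflowA {chain zero}    _ _ = peak , peak-min (s≤s z≤n) a<ᵇ1+a refl , chain≼peak
  rowComplete-overflowA {chain (suc i)} _ ()
  rowComplete-overflowA {valley}        _ _ = peak , peak-min (s≤s z≤n) a<ᵇ1+a refl , valley≼peak
  rowComplete-overflowA {peak}          _ _ = peak , peak-min (s≤s z≤n) a<ᵇ1+a refl , peak≼peak

  rowSound-overflowC : RowSound (C , suc a) (A , 0)
  rowSound-overflowC (chain-min 1+a≤a _) _ = ⊥-elim (<-irrefl refl 1+a≤a)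
  rowSound-overflowC (valley-min ()) _
  rowSound-overflowC (peak-min _ _ ()) _

  rowComplete-overflowC : RowComplete (C , suc a) (A , 0)
  rowComplete-overflowC {chain i} _ ()
  rowComplete-overflowC {valley}  _ ()
  rowComplete-overflowC {peak}    _ ()

  row-F : ∀ {s} → Valid s → row (ideal s) ≡ ideal (F s)
  row-F v = row-view (stateView v)
    where
    step : ∀ {s t} → RowSound s t → RowComplete s t → F s ≡ t → row (ideal s) ≡ ideal (F s)
    step sound complete Fs≡t = trans (row-ideal sound complete) (cong ideal (sym Fs≡t))

    row-view : ∀ {s} → StateView s → row (ideal s) ≡ ideal (F s)
    row-view (below-A K<a)     = step (rowSound-A K<a) (rowComplete-A K<a) (F-below A K<a)
    row-view (below-B K>0 K<a) = step (rowSound-B K<a) (rowComplete-B K>0 K<a) (F-below B K<a)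
    row-view (below-C K<a)     = step (rowSound-C K<a) (rowComplete-C K<a) (F-below C K<a)
    row-view (at-top A)        = step rowSound-topA rowComplete-topA (F-top A)
    row-view (at-top B)        = step rowSound-topB rowComplete-topB (F-top B)
    row-view (at-top C)        = step rowSound-topC rowComplete-topC (F-top C)
    row-view overflow-A        = step rowSound-overflowA rowComplete-overflowA (F-overflow A)
    row-view overflow-C        = step rowSound-overflowC rowComplete-overflowC (F-overflow C)

  contains-down : ∀ s {e f} → e ≼ f → contains s f ≡ true → contains s e ≡ true
  contains-down (L , K) (chain≼chain i≤j _) j<K = <ᵇ-true (≤-<-trans i≤j (<ᵇ-true⁻ {n = K} j<K))
  contains-down (A , K) valley≼chain  a<K = a<K
  contains-down (B , K) valley≼chain  _   = refl
  contains-down (C , K) valley≼chain  _   = refl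
  contains-down s       valley≼valley e∈  = e∈
  contains-down s       peak≼peak     e∈  = e∈
  contains-down (C , K) valley≼peak   _   = refl
  contains-down (C , K) chain≼peak    0<K = 0<K

  ideal-isIdeal : ∀ s → IsIdeal (ideal s)
  ideal-isIdeal s x y x≤y y∈ =
    trans (lookup-subset (contains s) x)
      (contains-down s (leq-sound x y x≤y) (trans (sym (lookup-subset (contains s) y)) y∈))

  module IdealAsState (I : Subset n) (I-ideal : IsIdeal I) where

    P : Point → Bool
    P e = lookupℕ I (index e)

    P-el : ∀ x → P (el x) ≡ lookup I x
    P-el x = trans (cong (lookupℕ I) (index-el x)) (lookupℕ-toℕ I x)

    P-down : ∀ {e f} → InRange e → InRange f → e ≼ f → P f ≡ true → P e ≡ true
    P-down {e} {f} re rf e≼f f∈ =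
      subst (λ e′ → P e′ ≡ true) (el-fin re)
        (trans (P-el x) (I-ideal x y (leq-complete x y (subst₂ _≼_ (sym (el-fin re)) (sym (el-fin rf)) e≼f))
                                 (trans (sym (P-el y)) (subst (λ f′ → P f′ ≡ true) (sym (el-fin rf)) f∈))))
      where
      x y : Fin n
      x = fin e re
      y = fin f rf

    chain-initial : ∃[ K ] K ≤ suc a × (∀ i → i < suc a → P (chain i) ≡ (i <ᵇ K))
    chain-initial = downClosed-initial (P ∘ chain) (suc a)
      λ i≤j j<1+a → P-down (≤-trans i≤j (s≤s⁻¹ j<1+a)) (s≤s⁻¹ j<1+a) (chain≼chain i≤j (s≤s⁻¹ j<1+a))

    K : ℕ
    K = proj₁ chain-initial

    K≤1+a : K ≤ suc a
    K≤1+a = proj₁ (proj₂ chain-initial)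

    P-chain : ∀ i → i < suc a → P (chain i) ≡ (i <ᵇ K)
    P-chain = proj₂ (proj₂ chain-initial)

    as-state : ∀ {L} → P valley ≡ contains (L , K) valley → P peak ≡ contains (L , K) peak → I ≡ ideal (L , K)
    as-state {L} valley-agrees peak-agrees =
      subset-ext (contains (L , K)) λ x → trans (sym (P-el x)) (agree (el-inRange x))
      where
      agree : ∀ {e} → InRange e → P e ≡ contains (L , K) e
      agree {chain i} i≤a = P-chain i (s≤s i≤a)
      agree {valley}  _   = valley-agrees
      agree {peak}    _   = peak-agrees

    classify : ∀ {v p t b} → P valley ≡ v → P peak ≡ p → P (chain a) ≡ t → P (chain 0) ≡ b →
               ∃[ s ] Valid s × I ≡ ideal s
    classify {false} {true} v p _ _ = ⊥-elim (true⇒≢false (P-down tt tt valley≼peak p) v)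
    classify {true} {true} v p _ _ =
      (C , K) , valid-C K≤1+a , as-state v (trans p (trans (sym (P-down z≤n tt chain≼peak p)) (P-chain 0 z<s)))
    classify {false} {false} {true} v _ top _ = ⊥-elim (true⇒≢false (P-down tt ≤-refl valley≼chain top) v)
    classify {false} {false} {false} v p top _ =
      (A , K) , valid-A K≤1+a , as-state (trans v (trans (sym top) (P-chain a ≤-refl))) p
    classify {true} {false} {true} v p top _ =
      (A , K) , valid-A K≤1+a , as-state (trans v (trans (sym top) (P-chain a ≤-refl))) p
    classify {true} {false} {false} {true} v p top bottom =
      (B , K) , valid-B (<ᵇ-true⁻ (trans (sym (P-chain 0 z<s)) bottom))
                        (≮⇒≥ λ a<K → true⇒≢false (<ᵇ-true a<K) (trans (sym (P-chain a ≤-refl)) top)) ,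
      as-state v p
    classify {true} {false} {false} {false} v p _ bottom =
      (C , K) , valid-C K≤1+a , as-state v (trans p (trans (sym bottom) (P-chain 0 z<s)))

    state : ∃[ s ] Valid s × I ≡ ideal s
    state = classify refl refl refl refl

  ideal-state : ∀ I → IsIdeal I → ∃[ s ] Valid s × I ≡ ideal s
  ideal-state = IdealAsState.state

  contains-agree : ∀ {s t} → ideal s ≡ ideal t → ∀ {e} → InRange e → contains s e ≡ contains t e
  contains-agree {s} {t} same {e} r = begin
    contains s e             ≡⟨ cong (contains s) (el-fin r) ⟨
    contains s (el x)        ≡⟨ lookup-subset (contains s) x ⟨
    lookup (ideal s) x       ≡⟨ cong (λ S → lookup S x) same ⟩
    lookup (ideal t) x       ≡⟨ lookup-subset (contains t) x ⟩
    contains t (el x)        ≡⟨ cong (contains t) (el-fin r) ⟩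
    contains t e             ∎
    where
    x : Fin n
    x = fin e r

  valid-≤ : ∀ {L K} → Valid (L , K) → K ≤ suc a
  valid-≤ (valid-A K≤1+a) = K≤1+a
  valid-≤ (valid-B _ K≤a) = m≤n⇒m≤1+n K≤a
  valid-≤ (valid-C K≤1+a) = K≤1+a

  phase-injective : ∀ {L L′ K} → Valid (L , K) → Valid (L′ , K) →
                    contains (L , K) valley ≡ contains (L′ , K) valley →
                    contains (L , K) peak ≡ contains (L′ , K) peak → L ≡ L′
  phase-injective {A} {A} _ _ _ _ = refl
  phase-injective {B} {B} _ _ _ _ = refl
  phase-injective {C} {C} _ _ _ _ = refl
  phase-injective {A} {B} _ (valid-B _ K≤a) v _ = ⊥-elim (true⇒≢false v (<ᵇ-false K≤a))
  phase-injective {B} {A} (valid-B _ K≤a) _ v _ = ⊥-elim (true⇒≢false (sym v) (<ᵇ-false K≤a))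
  phase-injective {B} {C} (valid-B (s≤s z≤n) _) _ _ ()
  phase-injective {C} {B} _ (valid-B (s≤s z≤n) _) _ ()
  phase-injective {A} {C} {zero}  _ _ () _
  phase-injective {A} {C} {suc K} _ _ _ ()
  phase-injective {C} {A} {zero}  _ _ () _
  phase-injective {C} {A} {suc K} _ _ _ ()

  ideal-injective : ∀ {s t} → Valid s → Valid t → ideal s ≡ ideal t → s ≡ t
  ideal-injective {L , K} {L′ , K′} vs vt same with <-cmp K K′
  ... | tri< K<K′ _ _ = ⊥-elim (true⇒≢false (<ᵇ-true K<K′)
      (trans (sym (contains-agree same (s≤s⁻¹ (<-≤-trans K<K′ (valid-≤ vt))))) (<ᵇ-false (≤-refl {K}))))
  ... | tri> _ _ K′<K = ⊥-elim (true⇒≢false (<ᵇ-true K′<K)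
      (trans (contains-agree same (s≤s⁻¹ (<-≤-trans K′<K (valid-≤ vs)))) (<ᵇ-false (≤-refl {K′}))))
  ... | tri≈ _ refl _ =
    cong (_, K) (phase-injective vs vt (contains-agree same {e = valley} tt) (contains-agree same {e = peak} tt))

  open Semiconjugacy F row ideal Valid F-valid row-F

  period-ideal : ∀ {p s} → Valid s → MinimalPeriod F p s → IsPeriod (ideal s) p
  period-ideal = minimalPeriod-commutes ideal-injective

  inOrbit-ideal : ∀ {ℓ s t} → Valid s → t ∈ trajectory F ℓ s → InOrbit (ideal s) (ideal t)
  inOrbit-ideal vs t∈ with ∈-trajectory⁻ F t∈
  ... | k , _ , refl = k , iter-commutes k vs

  ¬inOrbit-ideal : ∀ {p s t} → Valid s → Valid t → iter F (suc p) s ≡ s → t ∉ trajectory F (suc p) s →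
                   ¬ InOrbit (ideal s) (ideal t)
  ¬inOrbit-ideal vs vt per t∉ (k , reaches) =
    t∉ (subst (_∈ _) (ideal-injective (P-iter k vs) vt (trans (sym (iter-commutes k vs)) reaches))
              (iter-∈-trajectory F per k))

  singleOrbit-of-cover : ∀ {p s} → Valid s → MinimalPeriod F (suc p) s →
                         (∀ {t} → Valid t → t ∈ trajectory F (suc p) s) → SingleOrbit (suc p)
  singleOrbit-of-cover {p} {s} vs period covers I I-ideal =
    subst (λ I′ → IsPeriod I′ (suc p) × (∀ J → IsIdeal J → InOrbit I′ J)) (sym I≡)
          (period-ideal (P-iter k vs) (minimalPeriod-iter F period k) , same-orbit)
    where
    on-cycle : ∀ J → IsIdeal J → ∃[ j ] J ≡ ideal (iter F j s)
    on-cycle J J-ideal =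
      let t , vt , J≡t = ideal-state J J-ideal
          j , _ , reaches = ∈-trajectory⁻ F (covers vt)
      in j , trans J≡t (cong ideal (sym reaches))

    k : ℕ
    k = proj₁ (on-cycle I I-ideal)

    I≡ : I ≡ ideal (iter F k s)
    I≡ = proj₂ (on-cycle I I-ideal)

    same-orbit : ∀ J → IsIdeal J → InOrbit (ideal (iter F k s)) J
    same-orbit J J-ideal =
      let j , J≡ = on-cycle J J-ideal
      in j + k * p , trans (trans (iter-commutes (j + k * p) (P-iter k vs))
                                  (cong ideal (iter-reaches F (proj₁ (proj₂ period)) k j)))
                           (sym J≡)

  rot : Phase → ℕ → Phase
  rot L k = iter next k L

  next³ : ∀ L → next (next (next L)) ≡ L
  next³ A = refl
  next³ B = refl
  next³ C = refl

  rot-suc : ∀ L k → rot (next L) k ≡ rot L (suc k)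
  rot-suc L k = iter-comm next k L

  -- next has order 3, so rot L (k * 2) is the phase k steps before L
  rot-onto : ∀ {L X} k → rot L (k * 2) ≡ X → rot X k ≡ L
  rot-onto {L} k refl = begin
    rot (rot L (k * 2)) k  ≡⟨ iter-+ next k (k * 2) L ⟨
    rot L (k + k * 2)      ≡⟨ cong (rot L) (trans (cong (k +_) (*-comm k 2)) (*-comm 3 k)) ⟩
    rot L (k * 3)          ≡⟨ iter-periodic next (next³ L) k ⟩
    L                      ∎

  run : Phase → ℕ → ℕ → List State
  run L K zero    = []
  run L K (suc j) = (L , K) ∷ run (next L) (suc K) j

  walk-run : ∀ L K j → K + j ≡ a → Walk F (suc j) (L , K) (run L K (suc j)) (top (rot L j))
  walk-run L K zero    K+0≡a = walk refl (trans (cong (λ k → F (L , k)) (trans (sym (+-identityʳ K)) K+0≡a)) (F-top L))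
  walk-run L K (suc j) K+j+1≡a =
    subst (Walk F (suc (suc j)) (L , K) (run L K (suc (suc j)))) (cong top (rot-suc L j))
      (walk-++ F (walk-step F (L , K))
        (subst (λ s → Walk F (suc j) s (run (next L) (suc K) (suc j)) (top (rot (next L) j)))
               (sym (F-below L K<a)) (walk-run (next L) (suc K) j (trans (sym (+-suc K j)) K+j+1≡a))))
    where
    K<a : K < a
    K<a = subst (K <_) K+j+1≡a (m<m+n K z<s)

  ∈-run⁺ : ∀ L K {i j} → i < j → (rot L i , K + i) ∈ run L K j
  ∈-run⁺ L K {zero}  {suc j} _ = here (cong (L ,_) (+-identityʳ K))
  ∈-run⁺ L K {suc i} {suc j} (s<s i<j) =
    there (subst₂ (λ L′ K′ → (L′ , K′) ∈ run (next L) (suc K) j) (rot-suc L i) (sym (+-suc K i))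
                  (∈-run⁺ (next L) (suc K) i<j))

  ∈-run⁻ : ∀ {L K j s} → s ∈ run L K j → ∃[ i ] i < j × s ≡ (rot L i , K + i)
  ∈-run⁻ {L} {K} {suc j} (here refl) = 0 , z<s , cong (L ,_) (sym (+-identityʳ K))
  ∈-run⁻ {L} {K} {suc j} (there s∈) with ∈-run⁻ s∈
  ... | i , i<j , refl = suc i , s<s i<j , cong₂ _,_ (rot-suc L i) (sym (+-suc K i))

  ∉-run : ∀ {L K j s} → (∀ i → s ≢ (rot L i , K + i)) → s ∉ run L K j
  ∉-run avoid s∈ with ∈-run⁻ s∈
  ... | i , _ , e = avoid i e

  data Location (s : State) : Set where
    on-A-run   : s ∈ run A 0 (suc a) → Location s
    on-C-run   : s ∈ run C 0 (suc a) → Location s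
    on-C₁-run  : s ∈ run C 1 a → Location s
    A-overflow : s ≡ (A , suc a) → Location s
    C-overflow : s ≡ (C , suc a) → Location s

  -- a state (L , K) with K ≤ a lies on the run started at phase rot L (2K)
  locate-below : ∀ {L K} → K ≤ a → Valid (L , K) → Location (L , K)
  locate-below {L} {K} K≤a v with rot L (K * 2) in start
  ... | A = on-A-run (subst (λ L′ → (L′ , K) ∈ _) (rot-onto K start) (∈-run⁺ A 0 (s≤s K≤a)))
  ... | C = on-C-run (subst (λ L′ → (L′ , K) ∈ _) (rot-onto K start) (∈-run⁺ C 0 (s≤s K≤a)))
  ... | B with K | v
  ...   | zero  | valid-A _ = on-A-run (here refl)
  ...   | zero  | valid-C _ = on-C-run (here refl)
  ...   | suc k | _ =
    on-C₁-run (subst (λ L′ → (L′ , suc k) ∈ _) (trans (rot-suc B k) (rot-onto (suc k) start)) (∈-run⁺ C 1 K≤a))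

  locate : ∀ {s} → Valid s → Location s
  locate {L , K} v with m≤n⇒m<n∨m≡n (valid-≤ v)
  ... | inj₁ K<1+a = locate-below (s≤s⁻¹ K<1+a) v
  locate {A , _} v | inj₂ refl = A-overflow refl
  locate {B , _} (valid-B _ 1+a≤a) | inj₂ refl = ⊥-elim (<-irrefl refl 1+a≤a)
  locate {C , _} v | inj₂ refl = C-overflow refl

  ∣ideal∣ : ∀ {L K} → K ≤ suc a →
            ∣ ideal (L , K) ∣ ≡ K + (bit (contains (L , K) valley) + bit (contains (L , K) peak))
  ∣ideal∣ {L} {K} K≤1+a = begin
    ∣ ideal (L , K) ∣                            ≡⟨ ∣tabulate∣ n g ⟩
    count g n                                    ≡⟨ cong (count g) (+-suc a 2) ⟩
    count g (suc a + 2)                          ≡⟨ count-+ g (suc a) 2 ⟩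
    count g (suc a) + count (λ i → g (suc a + i)) 2 ≡⟨ cong₂ _+_ chain-part ends ⟩
    K + (bit (contains (L , K) valley) + bit (contains (L , K) peak)) ∎
    where
    g : ℕ → Bool
    g i = contains (L , K) (point i)

    chain-part : count g (suc a) ≡ K
    chain-part = trans (count-cong (suc a) (λ i i<1+a → cong (contains (L , K)) (point-chain (s≤s⁻¹ i<1+a))))
                       (count-<ᵇ (suc a) K≤1+a)

    ends : count (λ i → g (suc a + i)) 2 ≡ bit (contains (L , K) valley) + bit (contains (L , K) peak)
    ends = trans (cong₂ (λ u v → bit (contains (L , K) u) + (bit (contains (L , K) v) + 0))
                        (trans (cong point (+-identityʳ (suc a))) point-valley)
                        (trans (cong point (+-comm (suc a) 1)) point-peak))
                 (cong (bit (contains (L , K) valley) +_) (+-identityʳ _))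

  extras : Phase → ℕ
  extras A = 0
  extras B = 1
  extras C = 2

  ∣ideal∣-below : ∀ {L K} → K ≤ a → L ≡ A ⊎ 0 < K → ∣ ideal (L , K) ∣ ≡ K + extras L
  ∣ideal∣-below {A} K≤a _ rewrite ∣ideal∣ {A} (m≤n⇒m≤1+n K≤a) | <ᵇ-false K≤a = refl
  ∣ideal∣-below {B} K≤a _ = ∣ideal∣ {B} (m≤n⇒m≤1+n K≤a)
  ∣ideal∣-below {C} K≤a (inj₂ (s≤s z≤n)) = ∣ideal∣ {C} (m≤n⇒m≤1+n K≤a)

  sizes : List State → ℕ
  sizes ss = sum (map (∣_∣ ∘ ideal) ss)

  sizes-++ : ∀ ss ts → sizes (ss ++ ts) ≡ sizes ss + sizes ts
  sizes-++ ss ts = trans (cong sum (map-++ (∣_∣ ∘ ideal) ss ts)) (sum-++ (map (∣_∣ ∘ ideal) ss) _)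

  chi-walk : ∀ {ℓ s xs t} → Valid s → Walk F ℓ s xs t → chi (ideal s) ℓ ≡ sizes xs
  chi-walk {ℓ} {s} {xs} vs (walk traj _) = begin
    chi (ideal s) ℓ                              ≡⟨ chi-trajectory (ideal s) ℓ ⟩
    sum (map ∣_∣ (trajectory row ℓ (ideal s)))   ≡⟨ cong (sum ∘ map ∣_∣) (trajectory-commutes ℓ vs) ⟩
    sum (map ∣_∣ (map ideal (trajectory F ℓ s))) ≡⟨ cong sum (map-∘ (trajectory F ℓ s)) ⟨
    sizes (trajectory F ℓ s)                     ≡⟨ cong sizes traj ⟩
    sizes xs                                     ∎

  extras-sum : Phase → ℕ → ℕ
  extras-sum L zero    = 0
  extras-sum L (suc j) = extras L + extras-sum (next L) j

  extras-sum-3 : ∀ L q r → extras-sum L (q * 3 + r) ≡ q * 3 + extras-sum L r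
  extras-sum-3 L zero    r = refl
  extras-sum-3 A (suc q) r = cong (3 +_) (extras-sum-3 A q r)
  extras-sum-3 B (suc q) r = cong (3 +_) (extras-sum-3 B q r)
  extras-sum-3 C (suc q) r = cong (3 +_) (extras-sum-3 C q r)

  -- Gauss's summation, doubled so that no division occurs
  sizes-run : ∀ L K j → K + j ≤ suc a → L ≡ A ⊎ 0 < K →
              2 * sizes (run L K j) + j ≡ j * (2 * K + j) + 2 * extras-sum L j
  sizes-run L K zero    _ _ = refl
  sizes-run L K (suc j) K+j+1≤1+a regular = begin
    2 * (∣ ideal (L , K) ∣ + X) + suc j
      ≡⟨ cong (λ s → 2 * (s + X) + suc j) (∣ideal∣-below K≤a regular) ⟩
    2 * ((K + extras L) + X) + suc j
      ≡⟨ regroup K (extras L) j X ⟩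
    (2 * X + j) + (2 * K + 2 * extras L + 1)
      ≡⟨ cong (_+ (2 * K + 2 * extras L + 1)) (sizes-run (next L) (suc K) j K+1+j≤1+a (inj₂ z<s)) ⟩
    (j * (2 * suc K + j) + 2 * D) + (2 * K + 2 * extras L + 1)
      ≡⟨ collect K (extras L) j D ⟩
    suc j * (2 * K + suc j) + 2 * (extras L + D) ∎
    where
    X D : ℕ
    X = sizes (run (next L) (suc K) j)
    D = extras-sum (next L) j

    K+1+j≤1+a : suc K + j ≤ suc a
    K+1+j≤1+a = subst (_≤ suc a) (+-suc K j) K+j+1≤1+a

    K≤a : K ≤ a
    K≤a = s≤s⁻¹ (≤-trans (s≤s (m≤m+n K j)) K+1+j≤1+a)

    regroup : ∀ K d j X → 2 * ((K + d) + X) + suc j ≡ (2 * X + j) + (2 * K + 2 * d + 1)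
    regroup = solve-∀

    collect : ∀ K d j D → (j * (2 * suc K + j) + 2 * D) + (2 * K + 2 * d + 1) ≡ suc j * (2 * K + suc j) + 2 * (d + D)
    collect = solve-∀

  walk-A : Walk F (suc a) (A , 0) (run A 0 (suc a)) (top (rot A a))
  walk-A = walk-run A 0 a refl

  walk-C : Walk F (suc a) (C , 0) (run C 0 (suc a)) (top (rot C a))
  walk-C = walk-run C 0 a refl

  walk-C₁ : Walk F a (C , 1) (run C 1 a) (top (rot C m))
  walk-C₁ = walk-run C 1 m refl

  walk-A-overflow : Walk F 1 (A , suc a) [ (A , suc a) ] (C , 1)
  walk-A-overflow = walk refl (F-overflow A)

  walk-C-overflow : Walk F 1 (C , suc a) [ (C , suc a) ] (A , 0)
  walk-C-overflow = walk refl (F-overflow C)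

  rot-a : ∀ {r} → a % 3 ≡ r → ∀ L → rot L a ≡ rot L r
  rot-a a%3≡r L = trans (iter-mod next (next³ L) a) (cong (rot L) a%3≡r)

  rot-m : ∀ L → rot L m ≡ next (next (rot L a))
  rot-m L = sym (next³ (rot L m))

  cycle-period : ∀ {ℓ s ss} → Valid s → Walk F (suc ℓ) s (s ∷ ss) s → s ∉ ss → IsPeriod (ideal s) (suc ℓ)
  cycle-period vs cycle s∉ss = period-ideal vs (cycle-minimalPeriod F cycle s∉ss)

  singleOrbit-of-tour : ∀ {ℓ ss} → Walk F (suc ℓ) (A , 0) ((A , 0) ∷ ss) (A , 0) → (A , 0) ∉ ss →
                        (∀ {t} → Location t → t ∈ (A , 0) ∷ ss) → SingleOrbit (suc ℓ)
  singleOrbit-of-tour cycle avoids on-cycle =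
    singleOrbit-of-cover (valid-A z≤n) (cycle-minimalPeriod F cycle avoids)
                 (λ {t} vt → subst (t ∈_) (sym (Walk.visits cycle)) (on-cycle (locate vt)))

  singleOrbit-mod0 : a % 3 ≡ 0 → SingleOrbit (3 * a + 4)
  singleOrbit-mod0 a%3≡0 = subst SingleOrbit (length a) (singleOrbit-of-tour cycle avoids on-cycle)
    where
    tour : List State
    tour = run A 0 (suc a) ++ run C 0 (suc a) ++ [ (A , suc a) ] ++ run C 1 a ++ [ (C , suc a) ]

    cycle : Walk F (suc a + (suc a + (1 + (a + 1)))) (A , 0) tour (A , 0)
    cycle = walk-++ F (walk-to F walk-A (cong top (rot-a a%3≡0 A)))
           (walk-++ F (walk-to F walk-C (cong top (rot-a a%3≡0 C)))
           (walk-++ F walk-A-overflow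
           (walk-++ F (walk-to F walk-C₁ (cong top (trans (rot-m C) (cong (next ∘ next) (rot-a a%3≡0 C)))))
            walk-C-overflow)))

    avoids : (A , 0) ∉ run B 1 a ++ run C 0 (suc a) ++ [ (A , suc a) ] ++ run C 1 a ++ [ (C , suc a) ]
    avoids = ∉-++ (run B 1 a) (∉-run λ i ()) (∉-++ (run C 0 (suc a)) (∉-run λ { zero (); (suc i) () })
             (∉-++ [ (A , suc a) ] (λ { (here ()) }) (∉-++ (run C 1 a) (∉-run λ i ()) (λ { (here ()) }))))

    on-cycle : ∀ {t} → Location t → t ∈ tour
    on-cycle (on-A-run t∈)   = ∈-++⁺ˡ t∈
    on-cycle (on-C-run t∈)   = ∈-++⁺ʳ (run A 0 (suc a)) (∈-++⁺ˡ t∈)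
    on-cycle (A-overflow refl) = ∈-++⁺ʳ (run A 0 (suc a)) (∈-++⁺ʳ (run C 0 (suc a)) (here refl))
    on-cycle (on-C₁-run t∈)  = ∈-++⁺ʳ (run A 0 (suc a)) (∈-++⁺ʳ (run C 0 (suc a)) (there (∈-++⁺ˡ t∈)))
    on-cycle (C-overflow refl) =
      ∈-++⁺ʳ (run A 0 (suc a)) (∈-++⁺ʳ (run C 0 (suc a)) (there (∈-++⁺ʳ (run C 1 a) (here refl))))

    length : ∀ x → suc x + (suc x + (1 + (x + 1))) ≡ 3 * x + 4
    length = solve-∀

  singleOrbit-mod2 : a % 3 ≡ 2 → SingleOrbit (3 * a + 4)
  singleOrbit-mod2 a%3≡2 = subst SingleOrbit (length a) (singleOrbit-of-tour cycle avoids on-cycle)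
    where
    tour : List State
    tour = run A 0 (suc a) ++ [ (A , suc a) ] ++ run C 1 a ++ run C 0 (suc a) ++ [ (C , suc a) ]

    cycle : Walk F (suc a + (1 + (a + (suc a + 1)))) (A , 0) tour (A , 0)
    cycle = walk-++ F (walk-to F walk-A (cong top (rot-a a%3≡2 A)))
           (walk-++ F walk-A-overflow
           (walk-++ F (walk-to F walk-C₁ (cong top (trans (rot-m C) (cong (next ∘ next) (rot-a a%3≡2 C)))))
           (walk-++ F (walk-to F walk-C (cong top (rot-a a%3≡2 C)))
            walk-C-overflow)))

    avoids : (A , 0) ∉ run B 1 a ++ [ (A , suc a) ] ++ run C 1 a ++ run C 0 (suc a) ++ [ (C , suc a) ]
    avoids = ∉-++ (run B 1 a) (∉-run λ i ()) (∉-++ [ (A , suc a) ] (λ { (here ()) })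
             (∉-++ (run C 1 a) (∉-run λ i ())
             (∉-++ (run C 0 (suc a)) (∉-run λ { zero (); (suc i) () }) (λ { (here ()) }))))

    on-cycle : ∀ {t} → Location t → t ∈ tour
    on-cycle (on-A-run t∈)   = ∈-++⁺ˡ t∈
    on-cycle (A-overflow refl) = ∈-++⁺ʳ (run A 0 (suc a)) (here refl)
    on-cycle (on-C₁-run t∈)  = ∈-++⁺ʳ (run A 0 (suc a)) (there (∈-++⁺ˡ t∈))
    on-cycle (on-C-run t∈)   = ∈-++⁺ʳ (run A 0 (suc a)) (there (∈-++⁺ʳ (run C 1 a) (∈-++⁺ˡ t∈)))
    on-cycle (C-overflow refl) =
      ∈-++⁺ʳ (run A 0 (suc a)) (there (∈-++⁺ʳ (run C 1 a) (∈-++⁺ʳ (run C 0 (suc a)) (here refl))))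

    length : ∀ x → suc x + (1 + (x + (suc x + 1))) ≡ 3 * x + 4
    length = solve-∀

  singleOrbit-homomesic : a % 3 ≡ 0 ⊎ a % 3 ≡ 2 → SingleOrbit (3 * a + 4) × Homomesic
  singleOrbit-homomesic a%3 = orbit , singleOrbit⇒homomesic (3 * a + 4) orbit
    where
    orbit : SingleOrbit (3 * a + 4)
    orbit = [ singleOrbit-mod0 , singleOrbit-mod2 ]′ a%3

  inOrbit-cycle : ∀ {ℓ s ss s′ t} → Valid s → Walk F ℓ s ss s′ → t ∈ ss → InOrbit (ideal s) (ideal t)
  inOrbit-cycle {t = t} vs w t∈ = inOrbit-ideal vs (subst (t ∈_) (sym (Walk.visits w)) t∈)

  ¬inOrbit-cycle : ∀ {ℓ s ss t} → Valid s → Valid t → Walk F (suc ℓ) s ss s → t ∉ ss →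
                   ¬ InOrbit (ideal s) (ideal t)
  ¬inOrbit-cycle {t = t} vs vt w t∉ =
    ¬inOrbit-ideal vs vt (Walk.arrives w) (λ t∈ → t∉ (subst (t ∈_) (Walk.visits w) t∈))

  ThreeOrbits : Set
  ThreeOrbits =
    Σ _ λ I₁ → Σ _ λ I₂ → Σ _ λ I₃ →
      IsIdeal I₁ × IsIdeal I₂ × IsIdeal I₃
      × IsPeriod I₁ (a + 2) × IsPeriod I₂ (a + 1) × IsPeriod I₃ (a + 1)
      × ¬ InOrbit I₁ I₂ × ¬ InOrbit I₁ I₃ × ¬ InOrbit I₂ I₃
      × (∀ J → IsIdeal J → InOrbit I₁ J ⊎ InOrbit I₂ J ⊎ InOrbit I₃ J)
      × (2 * chi I₁ (a + 2) ≡ (a + 2) * (a + 3))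
      × (2 * chi I₂ (a + 1) ≡ (a + 2) * (a + 3))
      × (2 * chi I₃ (a + 1) ≡ a * (a + 3))

  module ThreeCycles (a%3≡1 : a % 3 ≡ 1) where

    vA₀ : Valid (A , 0)
    vA₀ = valid-A z≤n

    vC₀ : Valid (C , 0)
    vC₀ = valid-C z≤n

    vC₁ : Valid (C , 1)
    vC₁ = valid-C (s≤s z≤n)

    cycle-A : Walk F (suc a + 1) (A , 0) (run A 0 (suc a) ++ [ (C , suc a) ]) (A , 0)
    cycle-A = walk-++ F (walk-to F walk-A (cong top (rot-a a%3≡1 A))) walk-C-overflow

    cycle-C₁ : Walk F (a + 1) (C , 1) (run C 1 a ++ [ (A , suc a) ]) (C , 1)
    cycle-C₁ = walk-++ F (walk-to F walk-C₁ (cong top (trans (rot-m C) (cong (next ∘ next) (rot-a a%3≡1 C)))))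
                       walk-A-overflow

    cycle-C : Walk F (suc a) (C , 0) (run C 0 (suc a)) (C , 0)
    cycle-C = walk-to F walk-C (cong top (rot-a a%3≡1 C))

    period-A : IsPeriod (ideal (A , 0)) (a + 2)
    period-A = subst (IsPeriod _) (sym (+-suc a 1))
                     (cycle-period vA₀ cycle-A (∉-++ (run B 1 a) (∉-run λ i ()) λ { (here ()) }))

    period-C₁ : IsPeriod (ideal (C , 1)) (a + 1)
    period-C₁ = cycle-period vC₁ cycle-C₁ (∉-++ (run A 2 m) (∉-run λ i ()) λ { (here ()) })

    period-C : IsPeriod (ideal (C , 0)) (a + 1)
    period-C = subst (IsPeriod _) (+-comm 1 a) (cycle-period vC₀ cycle-C (∉-run λ i ()))

    A∌C₁ : ¬ InOrbit (ideal (A , 0)) (ideal (C , 1))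
    A∌C₁ = ¬inOrbit-cycle vA₀ vC₁ cycle-A
             (∉-++ (run A 0 (suc a)) (∉-run λ { zero (); (suc zero) (); (suc (suc i)) () }) λ { (here ()) })

    A∌C : ¬ InOrbit (ideal (A , 0)) (ideal (C , 0))
    A∌C = ¬inOrbit-cycle vA₀ vC₀ cycle-A (∉-++ (run A 0 (suc a)) (∉-run λ { zero (); (suc i) () }) λ { (here ()) })

    C₁∌C : ¬ InOrbit (ideal (C , 1)) (ideal (C , 0))
    C₁∌C = ¬inOrbit-cycle vC₁ vC₀ cycle-C₁ (∉-++ (run C 1 a) (∉-run λ i ()) λ { (here ()) })

    InSomeOrbit : Subset n → Set
    InSomeOrbit J = InOrbit (ideal (A , 0)) J ⊎ InOrbit (ideal (C , 1)) J ⊎ InOrbit (ideal (C , 0)) J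

    located-in-orbit : ∀ {t} → Location t → InSomeOrbit (ideal t)
    located-in-orbit (on-A-run t∈)     = inj₁ (inOrbit-cycle vA₀ cycle-A (∈-++⁺ˡ t∈))
    located-in-orbit (C-overflow refl) = inj₁ (inOrbit-cycle vA₀ cycle-A (∈-++⁺ʳ (run A 0 (suc a)) (here refl)))
    located-in-orbit (on-C₁-run t∈)    = inj₂ (inj₁ (inOrbit-cycle vC₁ cycle-C₁ (∈-++⁺ˡ t∈)))
    located-in-orbit (A-overflow refl) = inj₂ (inj₁ (inOrbit-cycle vC₁ cycle-C₁ (∈-++⁺ʳ (run C 1 a) (here refl))))
    located-in-orbit (on-C-run t∈)     = inj₂ (inj₂ (inOrbit-cycle vC₀ cycle-C t∈))

    in-some-orbit : ∀ J → IsIdeal J → InSomeOrbit J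
    in-some-orbit J J-ideal =
      let t , vt , J≡t = ideal-state J J-ideal in subst InSomeOrbit (sym J≡t) (located-in-orbit (locate vt))

    b : ℕ
    b = a / 3

    a≡3b+1 : a ≡ b * 3 + 1
    a≡3b+1 = trans (m≡m%n+[m/n]*n a 3) (trans (cong (_+ b * 3) a%3≡1) (+-comm 1 (b * 3)))

    extras-sum-A-run : extras-sum A (suc a) ≡ a
    extras-sum-A-run = begin
      extras-sum A (suc a)     ≡⟨ cong (extras-sum A) (trans (cong suc a≡3b+1) (sym (+-suc (b * 3) 1))) ⟩
      extras-sum A (b * 3 + 2) ≡⟨ extras-sum-3 A b 2 ⟩
      b * 3 + 1                ≡⟨ a≡3b+1 ⟨
      a                        ∎

    extras-sum-C₁-run : extras-sum C a ≡ suc a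
    extras-sum-C₁-run = begin
      extras-sum C a           ≡⟨ cong (extras-sum C) a≡3b+1 ⟩
      extras-sum C (b * 3 + 1) ≡⟨ extras-sum-3 C b 1 ⟩
      b * 3 + 2                ≡⟨ +-suc (b * 3) 1 ⟩
      suc (b * 3 + 1)          ≡⟨ cong suc a≡3b+1 ⟨
      suc a                    ∎

    extras-sum-A₁-run : suc (extras-sum A a) ≡ a
    extras-sum-A₁-run = begin
      suc (extras-sum A a)           ≡⟨ cong (suc ∘ extras-sum A) a≡3b+1 ⟩
      suc (extras-sum A (b * 3 + 1)) ≡⟨ cong suc (extras-sum-3 A b 1) ⟩
      suc (b * 3 + 0)                ≡⟨ +-suc (b * 3) 0 ⟨
      b * 3 + 1                      ≡⟨ a≡3b+1 ⟨
      a                              ∎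

    sizes-C-overflow : sizes [ (C , suc a) ] ≡ a + 3
    sizes-C-overflow = trans (+-identityʳ _) (trans (∣ideal∣ ≤-refl) (sym (+-suc a 2)))

    sizes-A-overflow : sizes [ (A , suc a) ] ≡ a + 2
    sizes-A-overflow = trans (+-identityʳ _)
      (trans (∣ideal∣ ≤-refl) (trans (cong (λ v → suc a + (bit v + 0)) a<ᵇ1+a) (sym (+-suc a 1))))

    chi-A : 2 * chi (ideal (A , 0)) (a + 2) ≡ (a + 2) * (a + 3)
    chi-A = begin
      2 * chi (ideal (A , 0)) (a + 2)
        ≡⟨ cong (2 *_) (trans (cong (chi (ideal (A , 0))) (+-suc a 1)) (chi-walk vA₀ cycle-A)) ⟩
      2 * sizes (run A 0 (suc a) ++ [ (C , suc a) ])
        ≡⟨ cong (2 *_) (trans (sizes-++ (run A 0 (suc a)) _) (cong (S +_) sizes-C-overflow)) ⟩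
      2 * (S + (a + 3))
        ≡⟨ double-sum S (suc a) (a + 3) run-sum (identity a) ⟩
      (a + 2) * (a + 3) ∎
      where
      S : ℕ
      S = sizes (run A 0 (suc a))

      run-sum : 2 * S + suc a ≡ suc a * suc a + 2 * a
      run-sum = trans (sizes-run A 0 (suc a) ≤-refl (inj₁ refl)) (cong (λ d → suc a * suc a + 2 * d) extras-sum-A-run)

      identity : ∀ x → (suc x * suc x + 2 * x) + 2 * (x + 3) ≡ (x + 2) * (x + 3) + suc x
      identity = solve-∀

    chi-C₁ : 2 * chi (ideal (C , 1)) (a + 1) ≡ (a + 2) * (a + 3)
    chi-C₁ = begin
      2 * chi (ideal (C , 1)) (a + 1)
        ≡⟨ cong (2 *_) (chi-walk vC₁ cycle-C₁) ⟩
      2 * sizes (run C 1 a ++ [ (A , suc a) ])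
        ≡⟨ cong (2 *_) (trans (sizes-++ (run C 1 a) _) (cong (S +_) sizes-A-overflow)) ⟩
      2 * (S + (a + 2))
        ≡⟨ double-sum S a (a + 2) run-sum (identity a) ⟩
      (a + 2) * (a + 3) ∎
      where
      S : ℕ
      S = sizes (run C 1 a)

      run-sum : 2 * S + a ≡ a * (2 + a) + 2 * suc a
      run-sum = trans (sizes-run C 1 a ≤-refl (inj₂ z<s)) (cong (λ d → a * (2 + a) + 2 * d) extras-sum-C₁-run)

      identity : ∀ x → (x * (2 + x) + 2 * suc x) + 2 * (x + 2) ≡ (x + 2) * (x + 3) + x
      identity = solve-∀

    chi-C : 2 * chi (ideal (C , 0)) (a + 1) ≡ a * (a + 3)
    chi-C = begin
      2 * chi (ideal (C , 0)) (a + 1)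
        ≡⟨ cong (2 *_) (trans (cong (chi (ideal (C , 0))) (+-comm a 1)) (chi-walk vC₀ cycle-C)) ⟩
      2 * (∣ ideal (C , 0) ∣ + S)
        ≡⟨ cong (λ s → 2 * (s + S)) (∣ideal∣ z≤n) ⟩
      2 * (1 + S)
        ≡⟨ cong (2 *_) (+-comm 1 S) ⟩
      2 * (S + 1)
        ≡⟨ double-sum S a 1 run-sum (subst closes extras-sum-A₁-run (identity (extras-sum A a))) ⟩
      a * (a + 3) ∎
      where
      S : ℕ
      S = sizes (run A 1 a)

      run-sum : 2 * S + a ≡ a * (2 + a) + 2 * extras-sum A a
      run-sum = sizes-run A 1 a ≤-refl (inj₁ refl)

      closes : ℕ → Set
      closes x = (x * (2 + x) + 2 * extras-sum A a) + 2 * 1 ≡ x * (x + 3) + x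

      identity : ∀ d → (suc d * (2 + suc d) + 2 * d) + 2 * 1 ≡ suc d * (suc d + 3) + suc d
      identity = solve-∀

  threeOrbits-mod1 : a % 3 ≡ 1 → ThreeOrbits
  threeOrbits-mod1 a%3≡1 =
    ideal (A , 0) , ideal (C , 1) , ideal (C , 0) ,
    ideal-isIdeal _ , ideal-isIdeal _ , ideal-isIdeal _ ,
    period-A , period-C₁ , period-C ,
    A∌C₁ , A∌C , C₁∌C ,
    in-some-orbit ,
    chi-A , chi-C₁ , chi-C
    where open ThreeCycles a%3≡1

theorem8p7 : (a : ℕ) → 1 ≤ a →
    let open CircularFence (fenceA111 a) in
    ((a % 3 ≡ 0 ⊎ a % 3 ≡ 2) →
       (∀ I → IsIdeal I → IsPeriod I (3 * a + 4) × (∀ J → IsIdeal J → InOrbit I J))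
       × Homomesic)
    × (a % 3 ≡ 1 →
       Σ _ λ I₁ → Σ _ λ I₂ → Σ _ λ I₃ →
         IsIdeal I₁ × IsIdeal I₂ × IsIdeal I₃
         × IsPeriod I₁ (a + 2) × IsPeriod I₂ (a + 1) × IsPeriod I₃ (a + 1)
         × ¬ InOrbit I₁ I₂ × ¬ InOrbit I₁ I₃ × ¬ InOrbit I₂ I₃
         × (∀ J → IsIdeal J → InOrbit I₁ J ⊎ InOrbit I₂ J ⊎ InOrbit I₃ J)
         × (2 * chi I₁ (a + 2) ≡ (a + 2) * (a + 3))
         × (2 * chi I₂ (a + 1) ≡ (a + 2) * (a + 3))
         × (2 * chi I₃ (a + 1) ≡ a * (a + 3)))
theorem8p7 (suc m) _ = FenceA111.singleOrbit-homomesic m , FenceA111.threeOrbits-mod1 m
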